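{- Let $w=a_0^{k_0}y_1a_1^{k_1}\cdots y_na_n^{k_n}$ be a $\mathcal G$-factorization and $0\le i\le j\le n$. Then $w_{i,j}$ lies in the cyclic subgroup $\langle a_i\rangle$ of $F(\mathcal G)$ if and only if $\mathcal C(w_{i,j})=[i+1]\cdots[j]$ represents the identity in the free group $F(\Lambda_w)$.
   Context: A GBS graph of groups $\mathcal G$: a finite connected graph $Y$ in Serre's sense (vertices $V(Y)$, edges $E(Y)$, maps $\iota,\tau$, fixed-point-free involution $y\mapsto\bar y$ with $\iota(y)=\tau(\bar y)$) and integers $\alpha_y,\beta_y\in\mathbb Z\setminus\{0\}$ with $\alpha_y=\beta_{\bar y}$. $F(\mathcal G)$ is the group generated by $V(Y)\cup E(Y)$ with relations $\bar yy=1$ and $y\,b^{\beta_y}\bar y=a^{\alpha_y}$ ($a=\iota(y)$, $b=\tau(y)$). A $\mathcal G$-factorization is a word $a_0^{k_0}y_1a_1^{k_1}\cdots y_na_n^{k_n}$ with $y_i\in E(Y)$, $\iota(y_i)=a_{i-1}$, $\tau(y_i)=a_i$, $a_n=a_0$, $k_i\in\mathbb Z$. Write $\alpha_\mu=\alpha_{y_\mu}$, $\beta_\mu=\beta_{y_\mu}$; for $0\le i\le j\le n$ let $w_{i,j}=a_i^{k_i}y_{i+1}\cdots y_ja_j^{k_j}$ and $k_{i,j}=\sum_{\nu=i}^{j}k_\nu\prod_{\mu=i+1}^{\nu}\frac{\alpha_\mu}{\beta_\mu}$. Fix an orientation $D\subseteq E(Y)$ and let $\rho$ be the monoid homomorphism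 to $\mathbb Z^D$ with $\rho(a^k)=0$, $\rho(y)=e_y$, $\rho(\bar y)=-e_y$ ($y\in D$). Define $i\sim_{\mathcal C}j$ on $\{1,\dots,n\}$ iff $y_i=\bar y_j$ and: if $i<j$, $\rho(w_{i,j-1})=0$ and $k_{i,j-1}\in\beta_i\mathbb Z$; if $j<i$, $\rho(w_{j,i-1})=0$ and $k_{j,i-1}\in\beta_j\mathbb Z$. Let $i\approx j$ iff $i=j$ or $i\sim_{\mathcal C}\ell\sim_{\mathcal C}j$ for some $\ell$; this is an equivalence relation with classes $[i]$. Let $\Sigma_w$ be the set of classes, and for each class set $\overline{[i]}=[j]$ if $i\sim_{\mathcal C}j$ for some $j$ (this is well defined), otherwise add a new symbol $\overline{[i]}$ to $\Sigma_w$; this gives a fixed-point-free involution on $\Sigma_w$. Choose $\Lambda_w\subseteq\Sigma_w$ containing exactly one of $x,\bar x$ for each pair, and let $F(\Lambda_w)$ be the free group on $\Lambda_w$ where $\bar x$ is interpreted as $x^{ -1}$. Set $\mathcal C(w_{i,j})=[i+1]\cdots[j]\in\Sigma_w^*$. -}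

module Defs where

open import Data.Nat as ℕ using (ℕ; zero; suc; _∸_; _<_; _≤_; _<?_; _≤?_)
open import Data.Integer as ℤ using (ℤ; +_; -[1+_])
open import Data.Rational as ℚ using (ℚ)
open import Data.Fin as Fin using (Fin; toℕ)
open import Data.Bool using (Bool; true; false; not; if_then_else_)
open import Data.List using (List; []; _∷_; _++_; map; foldr; upTo; replicate; reverse; concatMap; filter; allFin)
open import Data.Product using (Σ; _×_; _,_; ∃)
open import Data.Sum using (_⊎_; inj₁; inj₂)
open import Relation.Nullary using (¬_)
open import Relation.Nullary.Decidable using (⌊_⌋; _×-dec_)
open import Relation.Binary.PropositionalEquality using (_≡_; _≢_)
open import Relation.Binary.Construct.Closure.Equivalence using (EqClosure)

-- a letter g^{±1}; the Bool is true for the inverse letter g⁻¹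
Letter : Set → Set
Letter G = G × Bool

Word : Set → Set
Word G = List (Letter G)

invL : {G : Set} → Letter G → Letter G
invL (g , b) = (g , not b)

invW : {G : Set} → Word G → Word G
invW w = reverse (map invL w)

pow : {G : Set} → G → ℤ → Word G
pow g (+ n)    = replicate n (g , false)
pow g -[1+ n ] = replicate (suc n) (g , true)

data Step {G : Set} (R : Word G → Set) : Word G → Word G → Set where
  cancel : ∀ u v x → Step R (u ++ x ∷ invL x ∷ v) (u ++ v)
  delrel : ∀ u v r → R r → Step R (u ++ r ++ v) (u ++ v)

_≈[_]_ : {G : Set} → Word G → (Word G → Set) → Word G → Set
u ≈[ R ] v = EqClosure (Step R) u v

data NonZeroℤ : ℤ → Set where
  pos : ∀ n → NonZeroℤ (+ suc n)
  neg : ∀ n → NonZeroℤ -[1+ n ]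

record GBSGraph : Set where
  field
    nV nE : ℕ
    ι τ   : Fin nE → Fin nV
    bar   : Fin nE → Fin nE
    bar-invol : ∀ y → bar (bar y) ≡ y
    bar-fpf   : ∀ y → bar y ≢ y
    ι-bar     : ∀ y → ι y ≡ τ (bar y)
    α β       : Fin nE → ℤ
    α-nz      : ∀ y → NonZeroℤ (α y)
    β-nz      : ∀ y → NonZeroℤ (β y)
    α-β-bar   : ∀ y → α y ≡ β (bar y)

  data Reach : Fin nV → Fin nV → Set where
    here : ∀ v → Reach v v
    step : ∀ y {v} → Reach (τ y) v → Reach (ι y) v

  Connected : Set
  Connected = ∀ u v → Reach u v

  Gen : Set
  Gen = Fin nV ⊎ Fin nE

  vtx : Fin nV → Gen
  vtx = inj₁

  edg : Fin nE → Gen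
  edg = inj₂

  data Relator : Word Gen → Set where
    r-bar : ∀ y → Relator ((edg (bar y) , false) ∷ (edg y , false) ∷ [])
    r-bs  : ∀ y → Relator ((edg y , false) ∷ pow (vtx (τ y)) (β y)
                             ++ (edg (bar y) , false) ∷ invW (pow (vtx (ι y)) (α y)))

  _≈F_ : Word Gen → Word Gen → Set
  u ≈F v = u ≈[ Relator ] v

  record Orientation : Set where
    field
      inD : Fin nE → Bool
      inD-bar : ∀ y → inD (bar y) ≡ not (inD y)

-- the integer interval [i, j] (empty if j < i), increasing
range : ℕ → ℕ → List ℕ
range i j = map (i ℕ.+_) (upTo (suc j ∸ i))

sumℤ : List ℤ → ℤ
sumℤ = foldr ℤ._+_ (+ 0)

sumℚ : List ℚ → ℚ
sumℚ = foldr ℚ._+_ ℚ.0ℚ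

prodℚ : List ℚ → ℚ
prodℚ = foldr ℚ._*_ ℚ.1ℚ

-- the rational number a / b (b ≠ 0; value 0 for b = 0 is never used)
ratio : ℤ → ℤ → ℚ
ratio a (+ zero)   = ℚ.0ℚ
ratio a (+ suc m)  = a ℚ./ suc m
ratio a -[1+ m ]   = (ℤ.- a) ℚ./ suc m

fromℤ : ℤ → ℚ
fromℤ z = z ℚ./ 1

-- 𝒢-factorizations  a_0^{k_0} y_1 a_1^{k_1} ⋯ y_n a_n^{k_n}
-- (sequences indexed by ℕ; only the indices 0..n (for a,k) and 1..n (for y) matter)

record Factorization (𝒢 : GBSGraph) : Set where
  open GBSGraph 𝒢
  field
    n : ℕ
    a : ℕ → Fin nV
    k : ℕ → ℤ
    y : ℕ → Fin nE
    ι-y : ∀ i → 1 ≤ i → i ≤ n → ι (y i) ≡ a (i ∸ 1)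
    τ-y : ∀ i → 1 ≤ i → i ≤ n → τ (y i) ≡ a i
    closed : a n ≡ a 0

module _ (𝒢 : GBSGraph) (D : GBSGraph.Orientation 𝒢) (f : Factorization 𝒢) where
  open GBSGraph 𝒢
  open Orientation D
  open Factorization f

  α' β' : ℕ → ℤ
  α' μ = α (y μ)
  β' μ = β (y μ)

  wsub : ℕ → ℕ → Word Gen
  wsub i j = pow (vtx (a i)) (k i)
             ++ concatMap (λ μ → (edg (y μ) , false) ∷ pow (vtx (a μ)) (k μ)) (range (suc i) j)

  kk : ℕ → ℕ → ℚ
  kk i j = sumℚ (map (λ ν → fromℤ (k ν) ℚ.* prodℚ (map (λ μ → ratio (α' μ) (β' μ)) (range (suc i) ν)))
                     (range i j))

  -- ρ of an edge, as an element of ℤ^D (a function on D, extended by 0 off D)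
  ρE : Fin nE → Fin nE → ℤ
  ρE e d = if inD d
             then (if ⌊ e Fin.≟ d ⌋ then + 1 else (if ⌊ e Fin.≟ bar d ⌋ then -[1+ 0 ] else + 0))
             else + 0

  ρw : ℕ → ℕ → Fin nE → ℤ
  ρw i j d = sumℤ (map (λ μ → ρE (y μ) d) (range (suc i) j))

  ρ-zero : ℕ → ℕ → Set
  ρ-zero i j = ∀ d → inD d ≡ true → ρw i j d ≡ + 0

  _∈βℤ_ : ℚ → ℤ → Set
  q ∈βℤ b = ∃ λ (m : ℤ) → q ≡ fromℤ (b ℤ.* m)

  _∼C_ : ℕ → ℕ → Set
  i ∼C j = (y i ≡ bar (y j))
         × (i < j → ρ-zero i (j ∸ 1) × (kk i (j ∸ 1) ∈βℤ β' i))
         × (j < i → ρ-zero j (i ∸ 1) × (kk j (i ∸ 1) ∈βℤ β' j))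

  _≈C_ : ℕ → ℕ → Set
  i ≈C j = (i ≡ j) ⊎ (∃ λ ℓ → (1 ≤ ℓ) × (ℓ ≤ n) × (i ∼C ℓ) × (ℓ ∼C j))

  -- F(Λ_w): generator (m : Fin n) stands for the class [m+1] ∈ Σ_w.
  -- Relations: [i] = [j] when i ≈ j (generators are the classes), and
  -- [i][j] = 1 when i ∼_𝒞 j (i.e. \overline{[i]} = [j] is read as [i]⁻¹).
  -- Classes without partner are free generators.
  idx : Fin n → ℕ
  idx m = suc (toℕ m)

  data ΛRelator : Word (Fin n) → Set where
    r-class : ∀ p q → idx p ≈C idx q → ΛRelator ((p , false) ∷ (q , true) ∷ [])
    r-inv   : ∀ p q → idx p ∼C idx q → ΛRelator ((p , false) ∷ (q , false) ∷ [])

  𝒞 : ℕ → ℕ → Word (Fin n)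
  𝒞 i j = map (λ m → (m , false))
               (filter (λ m → (i <? idx m) ×-dec (idx m ≤? j)) (allFin n))

  InCyclic : ℕ → ℕ → Set
  InCyclic i j = ∃ λ (m : ℤ) → wsub i j ≈F pow (vtx (a i)) m

  𝒞Trivial : ℕ → ℕ → Set
  𝒞Trivial i j = 𝒞 i j ≈[ ΛRelator ] []

-- F(𝒢) acts on pairs (freely reduced stack of symbols, point). A point carries a level l ∈ ℤ^D, a
-- position T ∈ ℚ and a scale s ∈ ℚ: a vertex generator translates T by s, and an edge y pushes the
-- symbol (y , l , T mod α_y s) and moves to level l + ρ(y) and scale s α_y/β_y. Both kinds of
-- relators act trivially, and the scale is the function ∏_d (α_d/β_d)^{l_d} of the level. Along w,
-- the symbols pushed by y_p and y_q (p < q) are mutually inverse exactly when p ∼_𝒞 q: reversed edges,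
-- equal levels (ρ(w_{p,q-1}) = 0) and equal residues (k_{p,q-1} ∈ β_p ℤ). So w_{i,j} ∈ ⟨a_i⟩ leaves
-- an empty stack, and that stack is the free reduction of 𝒞(w_{i,j}) in F(Λ_w). Conversely, if
-- 𝒞(w_{i,j}) = 1 the reduction empties, and every cancellation of y_p against y_q collapses
-- y_p w_{p,q-1} y_q into ⟨a_{p-1}⟩, since w_{p,q-1} = a_p^{k_{p,q-1}} with k_{p,q-1} = β_p z and
-- y_p a^{β_p z} ȳ_p = a^{α_p z}.

module Submission where

open import Data.Nat as ℕ using (ℕ; zero; suc; _∸_; _≤_; _<_; _≤′_; ≤′-refl; ≤′-step; z≤n; s≤s; _⊓_; _<?_; _≤?_)
import Data.Nat.Properties as ℕP
open import Data.Integer as ℤ using (ℤ; +_; -[1+_])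
import Data.Integer.Properties as ℤP
import Data.Integer.DivMod as ℤD
open import Data.Rational as ℚ using (ℚ; mkℚ; 0ℚ; 1ℚ; _+_; _-_; _*_; -_; floor)
import Data.Rational.Properties as ℚP
open import Data.Rational.Unnormalised as ℚᵘ using (mkℚᵘ; *≡*; *≤*; *<*)
import Data.Rational.Unnormalised.Properties as ℚᵘP
open import Data.Rational.Solver using (module +-*-Solver)
open +-*-Solver using (solve; _:+_; _:*_; _:-_; :-_; _:=_; con)
open import Data.Fin as Fin using (Fin; toℕ)
import Data.Fin.Properties as FinP
open import Data.Vec as Vec using (Vec; lookup; zipWith)
import Data.Vec.Properties as VecP
open import Data.Vec.Functional using (Vector)
open import Data.Bool using (true; false; not; if_then_else_)
import Data.Bool.Properties as BoolP
open import Data.List using (List; []; _∷_; _++_; [_]; map; reverse; replicate; upTo; foldr; concatMap; filter; allFin; tabulate; applyUpTo)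
import Data.List.Properties as ListP
open import Data.List.Relation.Unary.Linked as Linked using (Linked; []; [-]; _∷_)
open import Data.Product using (_×_; _,_; proj₁; proj₂; ∃)
import Data.Product.Properties as ×P
open import Data.Sum using (inj₁; inj₂)
open import Function using (_⇔_; mk⇔; Equivalence; id; _∘_)
open import Function.Construct.Composition using (_⇔-∘_)
open import Function.Construct.Symmetry using (⇔-sym)
open import Algebra.Bundles using (Monoid; CommutativeMonoid; AbelianGroup)
import Algebra.Properties.CommutativeMonoid.Sum as MonoidSum
import Algebra.Properties.CommutativeSemigroup as CommSemigroupProperties
open import Algebra.Properties.Group ℚP.+-0-group using () renaming (∙-cancelˡ to ℚ+-cancelˡ)
open import Algebra.Properties.Group (AbelianGroup.group ℤP.+-0-abelianGroup) using () renaming (∙-cancelˡ to ℤ+-cancelˡ)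
open import Relation.Nullary using (yes; no; contradiction; Dec; does)
open import Relation.Nullary.Decidable using (_×-dec_)
open import Relation.Binary.Bundles using (Setoid)
open import Relation.Binary.Structures using (IsEquivalence)
open import Relation.Binary.Definitions using (DecidableEquality; tri<; tri≈; tri>)
open import Relation.Binary.PropositionalEquality using (_≡_; _≢_; refl; sym; trans; cong; cong₂; subst; subst₂; module ≡-Reasoning)
import Relation.Binary.Construct.Closure.Equivalence as EqClosure
import Relation.Binary.Reasoning.Setoid as SetoidReasoning
open import Defs

-- Rational arithmetic

toℚᵘ-fromℤ : ∀ z → ℚ.toℚᵘ (fromℤ z) ℚᵘ.≃ mkℚᵘ z 0
toℚᵘ-fromℤ z = ℚP.toℚᵘ-fromℚᵘ (mkℚᵘ z 0)

fromℤ-+ : ∀ a b → fromℤ (a ℤ.+ b) ≡ fromℤ a + fromℤ b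
fromℤ-+ a b = ℚP.toℚᵘ-injective (begin
  ℚ.toℚᵘ (fromℤ (a ℤ.+ b))                  ≈⟨ toℚᵘ-fromℤ (a ℤ.+ b) ⟩
  mkℚᵘ (a ℤ.+ b) 0                          ≈⟨ *≡* (cong (ℤ._* + 1) (sym (cong₂ ℤ._+_ (ℤP.*-identityʳ a) (ℤP.*-identityʳ b)))) ⟩
  mkℚᵘ a 0 ℚᵘ.+ mkℚᵘ b 0                   ≈⟨ ℚᵘP.+-cong (toℚᵘ-fromℤ a) (toℚᵘ-fromℤ b) ⟨
  ℚ.toℚᵘ (fromℤ a) ℚᵘ.+ ℚ.toℚᵘ (fromℤ b)   ≈⟨ ℚP.toℚᵘ-homo-+ (fromℤ a) (fromℤ b) ⟨
  ℚ.toℚᵘ (fromℤ a + fromℤ b)               ∎)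
  where open ℚᵘP.≃-Reasoning

fromℤ-* : ∀ a b → fromℤ (a ℤ.* b) ≡ fromℤ a * fromℤ b
fromℤ-* a b = ℚP.toℚᵘ-injective (begin
  ℚ.toℚᵘ (fromℤ (a ℤ.* b))                  ≈⟨ toℚᵘ-fromℤ (a ℤ.* b) ⟩
  mkℚᵘ a 0 ℚᵘ.* mkℚᵘ b 0                   ≈⟨ ℚᵘP.*-cong (toℚᵘ-fromℤ a) (toℚᵘ-fromℤ b) ⟨
  ℚ.toℚᵘ (fromℤ a) ℚᵘ.* ℚ.toℚᵘ (fromℤ b)   ≈⟨ ℚP.toℚᵘ-homo-* (fromℤ a) (fromℤ b) ⟨
  ℚ.toℚᵘ (fromℤ a * fromℤ b)               ∎)
  where open ℚᵘP.≃-Reasoning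

fromℤ-neg : ∀ a → fromℤ (ℤ.- a) ≡ - fromℤ a
fromℤ-neg a = ℚP.toℚᵘ-injective (ℚᵘP.≃-trans (toℚᵘ-fromℤ (ℤ.- a))
  (ℚᵘP.≃-sym (ℚᵘP.≃-trans (ℚP.toℚᵘ-homo‿- (fromℤ a)) (ℚᵘP.-‿cong (toℚᵘ-fromℤ a)))))

fromℤ-injective : ∀ {a b} → fromℤ a ≡ fromℤ b → a ≡ b
fromℤ-injective {a} {b} eq with ℚᵘP.≃-trans (ℚᵘP.≃-sym (toℚᵘ-fromℤ a)) (ℚᵘP.≃-trans (ℚP.toℚᵘ-cong eq) (toℚᵘ-fromℤ b))
... | *≡* a*1≡b*1 = trans (sym (ℤP.*-identityʳ a)) (trans a*1≡b*1 (ℤP.*-identityʳ b))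

fromℤ-cancel-< : ∀ {a b} → fromℤ a ℚ.< fromℤ b → a ℤ.< b
fromℤ-cancel-< {a} {b} lt with ℚᵘP.<-respˡ-≃ (toℚᵘ-fromℤ a) (ℚᵘP.<-respʳ-≃ (toℚᵘ-fromℤ b) (ℚP.toℚᵘ-mono-< lt))
... | *<* a*1<b*1 = subst₂ ℤ._<_ (ℤP.*-identityʳ a) (ℤP.*-identityʳ b) a*1<b*1

fromℤ≢0 : ∀ {b} → NonZeroℤ b → fromℤ b ≢ 0ℚ
fromℤ≢0 (pos m) eq with fromℤ-injective {+ suc m} {+ 0} eq
... | ()
fromℤ≢0 (neg m) eq with fromℤ-injective { -[1+ m ]} {+ 0} eq
... | ()

fromℤ-floor≤ : ∀ q → fromℤ (floor q) ℚ.≤ q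
fromℤ-floor≤ q@(mkℚ n d _) = ℚP.toℚᵘ-cancel-≤ (ℚᵘP.≤-respˡ-≃ (ℚᵘP.≃-sym (toℚᵘ-fromℤ (floor q))) (*≤* (begin
  floor q ℤ.* + suc d       ≡⟨ cong (ℤ._* + suc d) (ℤD.div-pos-is-/ℕ n (suc d)) ⟩
  (n ℤD./ℕ suc d) ℤ.* + suc d ≤⟨ ℤD.[n/ℕd]*d≤n n (suc d) ⟩
  n                         ≡⟨ ℤP.*-identityʳ n ⟨
  n ℤ.* + 1                 ∎)))
  where open ℤP.≤-Reasoning

<fromℤ-suc-floor : ∀ q → q ℚ.< fromℤ (ℤ.suc (floor q))
<fromℤ-suc-floor q@(mkℚ n d _) = ℚP.toℚᵘ-cancel-< (ℚᵘP.<-respʳ-≃ (ℚᵘP.≃-sym (toℚᵘ-fromℤ (ℤ.suc (floor q)))) (*<* (begin-strict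
  n ℤ.* + 1                         ≡⟨ ℤP.*-identityʳ n ⟩
  n                                 <⟨ ℤD.n<s[n/ℕd]*d n (suc d) ⟩
  ℤ.suc (n ℤD./ℕ suc d) ℤ.* + suc d ≡⟨ cong (λ f → ℤ.suc f ℤ.* + suc d) (ℤD.div-pos-is-/ℕ n (suc d)) ⟨
  ℤ.suc (floor q) ℤ.* + suc d       ∎)))
  where open ℤP.≤-Reasoning

floor-unique : ∀ {q z} → fromℤ z ℚ.≤ q → q ℚ.< fromℤ (ℤ.suc z) → floor q ≡ z
floor-unique {q} {z} z≤q q<z+1 = ℤP.≤-antisym (below (fromℤ-floor≤ q) q<z+1) (below z≤q (<fromℤ-suc-floor q))
  where
  below : ∀ {a b} → fromℤ a ℚ.≤ q → q ℚ.< fromℤ (ℤ.suc b) → a ℤ.≤ b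
  below a≤q q<b+1 = ℤP.≮⇒≥ λ b<a → ℤP.<-irrefl refl (ℤP.<-≤-trans (fromℤ-cancel-< (ℚP.≤-<-trans a≤q q<b+1)) (ℤP.i<j⇒suc[i]≤j b<a))

floor-+-fromℤ : ∀ q z → floor (q + fromℤ z) ≡ floor q ℤ.+ z
floor-+-fromℤ q z = floor-unique lower upper
  where
  lower : fromℤ (floor q ℤ.+ z) ℚ.≤ q + fromℤ z
  lower = subst (ℚ._≤ q + fromℤ z) (sym (fromℤ-+ (floor q) z)) (ℚP.+-monoˡ-≤ (fromℤ z) (fromℤ-floor≤ q))
  upper : q + fromℤ z ℚ.< fromℤ (ℤ.suc (floor q ℤ.+ z))
  upper = subst (q + fromℤ z ℚ.<_) (trans (sym (fromℤ-+ (ℤ.suc (floor q)) z)) (cong fromℤ (ℤP.+-assoc (+ 1) (floor q) z)))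
                (ℚP.+-monoˡ-< (fromℤ z) (<fromℤ-suc-floor q))

frac : ℚ → ℚ
frac q = q - fromℤ (floor q)

frac-+-fromℤ : ∀ q z → frac (q + fromℤ z) ≡ frac q
frac-+-fromℤ q z = begin
  q + fromℤ z - fromℤ (floor (q + fromℤ z))  ≡⟨ cong (λ f → q + fromℤ z - fromℤ f) (floor-+-fromℤ q z) ⟩
  q + fromℤ z - fromℤ (floor q ℤ.+ z)        ≡⟨ cong (λ f → q + fromℤ z - f) (fromℤ-+ (floor q) z) ⟩
  q + fromℤ z - (fromℤ (floor q) + fromℤ z)  ≡⟨ solve 3 (λ q z f → q :+ z :- (f :+ z) := q :- f) refl q (fromℤ z) (fromℤ (floor q)) ⟩
  frac q                                      ∎
  where open ≡-Reasoning

frac-≡⇒ : ∀ q q' → frac q ≡ frac q' → q ≡ q' + fromℤ (floor q ℤ.- floor q')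
frac-≡⇒ q q' eq = begin
  q                                   ≡⟨ solve 2 (λ q f → q := q :- f :+ f) refl q f ⟩
  frac q + f                          ≡⟨ cong (_+ f) eq ⟩
  frac q' + f                         ≡⟨ solve 3 (λ q f f' → q :- f' :+ f := q :+ (f :- f')) refl q' f f' ⟩
  q' + (f - f')                       ≡⟨ cong (λ x → q' + (f + x)) (fromℤ-neg (floor q')) ⟨
  q' + (f + fromℤ (ℤ.- floor q'))     ≡⟨ cong (λ x → q' + x) (fromℤ-+ (floor q) (ℤ.- floor q')) ⟨
  q' + fromℤ (floor q ℤ.- floor q')   ∎
  where
  open ≡-Reasoning
  f = fromℤ (floor q)
  f' = fromℤ (floor q')

*-cancelˡ-≢0 : ∀ p {x y} → p ≢ 0ℚ → p * x ≡ p * y → x ≡ y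
*-cancelˡ-≢0 p {x} {y} p≢0 eq = begin
  x                ≡⟨ ℚP.*-identityˡ x ⟨
  1ℚ * x           ≡⟨ cong (_* x) (ℚP.*-inverseˡ p) ⟨
  1/p * p * x      ≡⟨ ℚP.*-assoc 1/p p x ⟩
  1/p * (p * x)    ≡⟨ cong (1/p *_) eq ⟩
  1/p * (p * y)    ≡⟨ ℚP.*-assoc 1/p p y ⟨
  1/p * p * y      ≡⟨ cong (_* y) (ℚP.*-inverseˡ p) ⟩
  1ℚ * y           ≡⟨ ℚP.*-identityˡ y ⟩
  y                ∎
  where
  open ≡-Reasoning
  instance _ = ℚ.≢-nonZero p≢0
  1/p = ℚ.1/ p

*-≢0 : ∀ {p q} → p ≢ 0ℚ → q ≢ 0ℚ → p * q ≢ 0ℚ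
*-≢0 {p} p≢0 q≢0 pq≡0 = q≢0 (*-cancelˡ-≢0 p p≢0 (trans pq≡0 (sym (ℚP.*-zeroʳ p))))

-- A canonical label for the class T + Mℤ; junk value T when M = 0.
_mod_ : ℚ → ℚ → ℚ
T mod M with M ℚP.≟ 0ℚ
... | yes _  = T
... | no M≢0 = frac (T * ℚ.1/_ M {{ℚ.≢-nonZero M≢0}})

mod-periodic : ∀ T M z → (T + M * fromℤ z) mod M ≡ T mod M
mod-periodic T M z with M ℚP.≟ 0ℚ
... | yes refl = solve 2 (λ T z → T :+ con 0ℚ :* z := T) refl T (fromℤ z)
... | no M≢0 = trans (cong frac shift) (frac-+-fromℤ (T * 1/M) z)
  where
  instance _ = ℚ.≢-nonZero M≢0
  1/M = ℚ.1/ M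
  shift : (T + M * fromℤ z) * 1/M ≡ T * 1/M + fromℤ z
  shift = begin
    (T + M * fromℤ z) * 1/M        ≡⟨ solve 4 (λ T M z i → (T :+ M :* z) :* i := T :* i :+ (M :* i) :* z) refl T M (fromℤ z) 1/M ⟩
    T * 1/M + M * 1/M * fromℤ z    ≡⟨ cong (λ x → T * 1/M + x * fromℤ z) (ℚP.*-inverseʳ M) ⟩
    T * 1/M + 1ℚ * fromℤ z         ≡⟨ cong (λ x → T * 1/M + x) (ℚP.*-identityˡ (fromℤ z)) ⟩
    T * 1/M + fromℤ z              ∎
    where open ≡-Reasoning

mod-≡⇒ : ∀ {T T' M} → M ≢ 0ℚ → T mod M ≡ T' mod M → ∃ λ z → T ≡ T' + M * fromℤ z
mod-≡⇒ {T} {T'} {M} M≢0 eq with M ℚP.≟ 0ℚ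
... | yes M≡0 = contradiction M≡0 M≢0
... | no M≢0 = z , (begin
  T                              ≡⟨ M*[x*1/M] T ⟨
  M * (T * 1/M)                  ≡⟨ cong (M *_) (frac-≡⇒ (T * 1/M) (T' * 1/M) eq) ⟩
  M * (T' * 1/M + fromℤ z)       ≡⟨ ℚP.*-distribˡ-+ M (T' * 1/M) (fromℤ z) ⟩
  M * (T' * 1/M) + M * fromℤ z   ≡⟨ cong (_+ M * fromℤ z) (M*[x*1/M] T') ⟩
  T' + M * fromℤ z               ∎)
  where
  open ≡-Reasoning
  instance _ = ℚ.≢-nonZero M≢0
  1/M = ℚ.1/ M
  z = floor (T * 1/M) ℤ.- floor (T' * 1/M)
  M*[x*1/M] : ∀ x → M * (x * 1/M) ≡ x
  M*[x*1/M] x = trans (solve 3 (λ M x i → M :* (x :* i) := x :* (M :* i)) refl M x 1/M)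
                      (trans (cong (x *_) (ℚP.*-inverseʳ M)) (ℚP.*-identityʳ x))

+-*-mod-≡⇔ : ∀ {S} b T K → S ≢ 0ℚ → NonZeroℤ b →
             ((T + S * K) mod (fromℤ b * S) ≡ T mod (fromℤ b * S)) ⇔ (∃ λ m → K ≡ fromℤ (b ℤ.* m))
+-*-mod-≡⇔ {S} b T K S≢0 b≢0 = mk⇔ to from
  where
  bS = fromℤ b * S
  S*fromℤ[b*m] : ∀ m → S * fromℤ (b ℤ.* m) ≡ bS * fromℤ m
  S*fromℤ[b*m] m = trans (cong (S *_) (fromℤ-* b m)) (solve 3 (λ S b m → S :* (b :* m) := b :* S :* m) refl S (fromℤ b) (fromℤ m))
  to : (T + S * K) mod bS ≡ T mod bS → ∃ λ m → K ≡ fromℤ (b ℤ.* m)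
  to eq with mod-≡⇒ (*-≢0 (fromℤ≢0 b≢0) S≢0) eq
  ... | m , T+SK≡T+bSm = m , *-cancelˡ-≢0 S S≢0 (ℚ+-cancelˡ T _ _ (trans T+SK≡T+bSm (cong (λ x → T + x) (sym (S*fromℤ[b*m] m)))))
  from : (∃ λ m → K ≡ fromℤ (b ℤ.* m)) → (T + S * K) mod bS ≡ T mod bS
  from (m , refl) = trans (cong (λ x → (T + x) mod bS) (S*fromℤ[b*m] m)) (mod-periodic T bS m)

fromℤ-*-ratio : ∀ a {b} → NonZeroℤ b → fromℤ b * ratio a b ≡ fromℤ a
fromℤ-*-ratio a (pos m) = ℚP.toℚᵘ-injective (begin
  ℚ.toℚᵘ (fromℤ (+ suc m) * (a ℚ./ suc m))             ≈⟨ ℚP.toℚᵘ-homo-* (fromℤ (+ suc m)) (a ℚ./ suc m) ⟩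
  ℚ.toℚᵘ (fromℤ (+ suc m)) ℚᵘ.* ℚ.toℚᵘ (a ℚ./ suc m)  ≈⟨ ℚᵘP.*-cong (toℚᵘ-fromℤ (+ suc m)) (ℚP.toℚᵘ-fromℚᵘ (mkℚᵘ a m)) ⟩
  mkℚᵘ (+ suc m) 0 ℚᵘ.* mkℚᵘ a m                      ≈⟨ *≡* (trans (ℤP.*-identityʳ _) (trans (ℤP.*-comm (+ suc m) a)
                                                            (cong (λ x → a ℤ.* + suc x) (sym (ℕP.+-identityʳ m))))) ⟩
  mkℚᵘ a 0                                             ≈⟨ toℚᵘ-fromℤ a ⟨
  ℚ.toℚᵘ (fromℤ a)                                     ∎)
  where open ℚᵘP.≃-Reasoning
fromℤ-*-ratio a (neg m) = begin
  fromℤ (ℤ.- + suc m) * ratio a -[1+ m ]     ≡⟨ cong (_* ratio a -[1+ m ]) (fromℤ-neg (+ suc m)) ⟩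
  - fromℤ (+ suc m) * ratio a -[1+ m ]       ≡⟨ ℚP.neg-distribˡ-* (fromℤ (+ suc m)) (ratio a -[1+ m ]) ⟨
  - (fromℤ (+ suc m) * ratio (ℤ.- a) (+ suc m)) ≡⟨ cong -_ (fromℤ-*-ratio (ℤ.- a) (pos m)) ⟩
  - fromℤ (ℤ.- a)                            ≡⟨ cong -_ (fromℤ-neg a) ⟩
  - - fromℤ a                                ≡⟨ solve 1 (λ x → :- :- x := x) refl (fromℤ a) ⟩
  fromℤ a                                    ∎
  where open ≡-Reasoning

ratio≢0 : ∀ {a b} → NonZeroℤ a → NonZeroℤ b → ratio a b ≢ 0ℚ
ratio≢0 {a} {b} a≢0 b≢0 r≡0 = fromℤ≢0 a≢0 (begin
  fromℤ a               ≡⟨ fromℤ-*-ratio a b≢0 ⟨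
  fromℤ b * ratio a b   ≡⟨ cong (fromℤ b *_) r≡0 ⟩
  fromℤ b * 0ℚ          ≡⟨ ℚP.*-zeroʳ (fromℤ b) ⟩
  0ℚ                    ∎)
  where open ≡-Reasoning

ratio-*-ratio : ∀ {a b} → NonZeroℤ a → NonZeroℤ b → ratio a b * ratio b a ≡ 1ℚ
ratio-*-ratio {a} {b} a≢0 b≢0 = *-cancelˡ-≢0 (fromℤ b) (fromℤ≢0 b≢0) (begin
  fromℤ b * (ratio a b * ratio b a)   ≡⟨ ℚP.*-assoc (fromℤ b) (ratio a b) (ratio b a) ⟨
  fromℤ b * ratio a b * ratio b a     ≡⟨ cong (_* ratio b a) (fromℤ-*-ratio a b≢0) ⟩
  fromℤ a * ratio b a                 ≡⟨ fromℤ-*-ratio b a≢0 ⟩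
  fromℤ b                             ≡⟨ ℚP.*-identityʳ (fromℤ b) ⟨
  fromℤ b * 1ℚ                        ∎)
  where open ≡-Reasoning

-- Products and integer powers

module _ {c ℓ} (M : CommutativeMonoid c ℓ) where
  open CommutativeMonoid M
  open MonoidSum M using (sum; sum-cong-≋)
  open CommSemigroupProperties commutativeSemigroup using (xy∙z≈xz∙y)
  open SetoidReasoning setoid

  sum-agree-except : ∀ {n} (f g : Vector Carrier n) x c → (∀ d → d ≢ x → f d ≈ g d) → f x ≈ g x ∙ c → sum f ≈ sum g ∙ c
  sum-agree-except f g Fin.zero c f≈g fx≈gx∙c = begin
    f Fin.zero ∙ sum (λ d → f (Fin.suc d))        ≈⟨ ∙-cong fx≈gx∙c (sum-cong-≋ (λ d → f≈g (Fin.suc d) λ ())) ⟩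
    (g Fin.zero ∙ c) ∙ sum (λ d → g (Fin.suc d))  ≈⟨ xy∙z≈xz∙y _ _ _ ⟩
    sum g ∙ c                                     ∎
  sum-agree-except f g (Fin.suc x) c f≈g fx≈gx∙c = begin
    f Fin.zero ∙ sum (λ d → f (Fin.suc d))        ≈⟨ ∙-cong (f≈g Fin.zero λ ()) (sum-agree-except (λ d → f (Fin.suc d)) (λ d → g (Fin.suc d)) x c
                                                        (λ d d≢x → f≈g (Fin.suc d) (λ eq → d≢x (FinP.suc-injective eq))) fx≈gx∙c) ⟩
    g Fin.zero ∙ (sum (λ d → g (Fin.suc d)) ∙ c)  ≈⟨ assoc _ _ _ ⟨
    sum g ∙ c                                     ∎

powℤ : ℚ → ℚ → ℤ → ℚ
powℤ x x⁻¹ (+ zero)       = 1ℚ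
powℤ x x⁻¹ (+ suc n)      = x * powℤ x x⁻¹ (+ n)
powℤ x x⁻¹ -[1+ zero ]    = x⁻¹
powℤ x x⁻¹ -[1+ suc n ]   = x⁻¹ * powℤ x x⁻¹ -[1+ n ]

module _ {x x⁻¹ : ℚ} (x⁻¹*x≡1 : x⁻¹ * x ≡ 1ℚ) where

  powℤ-suc : ∀ z → powℤ x x⁻¹ (ℤ.suc z) ≡ powℤ x x⁻¹ z * x
  powℤ-suc (+ n)          = ℚP.*-comm x (powℤ x x⁻¹ (+ n))
  powℤ-suc -[1+ zero ]    = sym x⁻¹*x≡1
  powℤ-suc -[1+ suc n ]   = begin
    powℤ x x⁻¹ -[1+ n ]                ≡⟨ ℚP.*-identityʳ _ ⟨
    powℤ x x⁻¹ -[1+ n ] * 1ℚ           ≡⟨ cong (powℤ x x⁻¹ -[1+ n ] *_) x⁻¹*x≡1 ⟨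
    powℤ x x⁻¹ -[1+ n ] * (x⁻¹ * x)    ≡⟨ solve 3 (λ p i x → p :* (i :* x) := (i :* p) :* x) refl (powℤ x x⁻¹ -[1+ n ]) x⁻¹ x ⟩
    x⁻¹ * powℤ x x⁻¹ -[1+ n ] * x      ∎
    where open ≡-Reasoning

  powℤ-pred : ∀ z → powℤ x x⁻¹ (ℤ.pred z) ≡ powℤ x x⁻¹ z * x⁻¹
  powℤ-pred z = begin
    powℤ x x⁻¹ (ℤ.pred z)                    ≡⟨ ℚP.*-identityʳ _ ⟨
    powℤ x x⁻¹ (ℤ.pred z) * 1ℚ               ≡⟨ cong (powℤ x x⁻¹ (ℤ.pred z) *_) (trans (ℚP.*-comm x x⁻¹) x⁻¹*x≡1) ⟨
    powℤ x x⁻¹ (ℤ.pred z) * (x * x⁻¹)        ≡⟨ ℚP.*-assoc (powℤ x x⁻¹ (ℤ.pred z)) x x⁻¹ ⟨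
    powℤ x x⁻¹ (ℤ.pred z) * x * x⁻¹          ≡⟨ cong (_* x⁻¹) (powℤ-suc (ℤ.pred z)) ⟨
    powℤ x x⁻¹ (ℤ.suc (ℤ.pred z)) * x⁻¹      ≡⟨ cong (λ w → powℤ x x⁻¹ w * x⁻¹) (ℤP.suc-pred z) ⟩
    powℤ x x⁻¹ z * x⁻¹                       ∎
    where open ≡-Reasoning

-- Lists and ranges

range-empty : ∀ i t → t < i → range i t ≡ []
range-empty i t t<i = cong (λ m → map (i ℕ.+_) (upTo m)) (ℕP.m≤n⇒m∸n≡0 t<i)

range-∷ʳ : ∀ i t → i ≤ suc t → range i (suc t) ≡ range i t ++ [ suc t ]
range-∷ʳ i t i≤1+t = begin
  map (i ℕ.+_) (upTo (suc (suc t) ∸ i))            ≡⟨ cong (λ m → map (i ℕ.+_) (upTo m)) (ℕP.+-∸-assoc 1 i≤1+t) ⟩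
  map (i ℕ.+_) (upTo (suc (suc t ∸ i)))            ≡⟨ cong (map (i ℕ.+_)) (ListP.upTo-∷ʳ (suc t ∸ i)) ⟨
  map (i ℕ.+_) (upTo (suc t ∸ i) ++ [ suc t ∸ i ]) ≡⟨ ListP.map-++ (i ℕ.+_) (upTo (suc t ∸ i)) _ ⟩
  range i t ++ [ i ℕ.+ (suc t ∸ i) ]               ≡⟨ cong (λ m → range i t ++ [ m ]) (ℕP.m+[n∸m]≡n i≤1+t) ⟩
  range i t ++ [ suc t ]                           ∎
  where open ≡-Reasoning

range-single : ∀ i → range i i ≡ [ i ]
range-single zero    = refl
range-single (suc t) = trans (range-∷ʳ (suc t) t ℕP.≤-refl) (cong (_++ [ suc t ]) (range-empty (suc t) t ℕP.≤-refl))

module _ {c ℓ} (M : Monoid c ℓ) where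
  open Monoid M using (Carrier; _≈_; _∙_; ε; identityˡ; identityʳ; assoc; ∙-congˡ)
    renaming (trans to ≈-trans; sym to ≈-sym; reflexive to ≈-reflexive)

  foldr-∷ʳ : ∀ xs x → foldr _∙_ ε (xs ++ [ x ]) ≈ foldr _∙_ ε xs ∙ x
  foldr-∷ʳ []       x = ≈-trans (identityʳ x) (≈-sym (identityˡ x))
  foldr-∷ʳ (z ∷ xs) x = ≈-trans (∙-congˡ (foldr-∷ʳ xs x)) (≈-sym (assoc z _ x))

  foldr-map-range-∷ʳ : ∀ (g : ℕ → Carrier) i t → i ≤ suc t →
                       foldr _∙_ ε (map g (range i (suc t))) ≈ foldr _∙_ ε (map g (range i t)) ∙ g (suc t)
  foldr-map-range-∷ʳ g i t i≤1+t = ≈-trans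
    (≈-reflexive (cong (foldr _∙_ ε) (trans (cong (map g) (range-∷ʳ i t i≤1+t)) (ListP.map-++ g (range i t) [ suc t ]))))
    (foldr-∷ʳ (map g (range i t)) (g (suc t)))

map-≡[] : ∀ {A B : Set} (g : A → B) {xs} → map g xs ≡ [] → xs ≡ []
map-≡[] g {[]} _ = refl

map-filter : ∀ {A B : Set} {P : B → Set} (g : A → B) (P? : ∀ x → Dec (P x)) xs → map g (filter (P? ∘ g) xs) ≡ filter P? (map g xs)
map-filter g P? [] = refl
map-filter g P? (x ∷ xs) with does (P? (g x))
... | true  = cong (g x ∷_) (map-filter g P? xs)
... | false = map-filter g P? xs

tabulate-∘toℕ : ∀ {A : Set} n (h : ℕ → A) → tabulate {n = n} (h ∘ toℕ) ≡ applyUpTo h n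
tabulate-∘toℕ zero    h = refl
tabulate-∘toℕ (suc n) h = cong (h 0 ∷_) (tabulate-∘toℕ n (h ∘ suc))

map-suc∘toℕ-allFin : ∀ n → map (suc ∘ toℕ) (allFin n) ≡ range 1 n
map-suc∘toℕ-allFin n = trans (ListP.map-tabulate id (suc ∘ toℕ)) (trans (tabulate-∘toℕ n suc) (sym (ListP.map-upTo suc n)))

filter-range : ∀ i j b → filter (λ x → (i <? x) ×-dec (x ≤? j)) (range 1 b) ≡ range (suc i) (j ⊓ b)
filter-range i j zero = sym (range-empty (suc i) (j ⊓ 0) (subst (_< suc i) (sym (ℕP.⊓-zeroʳ j)) (s≤s z≤n)))
filter-range i j (suc b) = begin
  filter P? (range 1 (suc b))                   ≡⟨ cong (filter P?) (range-∷ʳ 1 b (s≤s z≤n)) ⟩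
  filter P? (range 1 b ++ [ suc b ])            ≡⟨ ListP.filter-++ P? (range 1 b) [ suc b ] ⟩
  filter P? (range 1 b) ++ filter P? [ suc b ]  ≡⟨ cong (_++ filter P? [ suc b ]) (filter-range i j b) ⟩
  range (suc i) (j ⊓ b) ++ filter P? [ suc b ]  ≡⟨ last (suc b ≤? j) (i <? suc b) ⟩
  range (suc i) (j ⊓ suc b)                     ∎
  where
  open ≡-Reasoning
  P? = λ x → (i <? x) ×-dec (x ≤? j)
  last : Dec (suc b ≤ j) → Dec (i < suc b) → range (suc i) (j ⊓ b) ++ filter P? [ suc b ] ≡ range (suc i) (j ⊓ suc b)
  last (no 1+b≰j) _ = begin
    range (suc i) (j ⊓ b) ++ filter P? [ suc b ]
      ≡⟨ cong (range (suc i) (j ⊓ b) ++_) (ListP.filter-reject P? (1+b≰j ∘ proj₂)) ⟩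
    range (suc i) (j ⊓ b) ++ []
      ≡⟨ ListP.++-identityʳ _ ⟩
    range (suc i) (j ⊓ b)
      ≡⟨ cong (range (suc i)) (trans (ℕP.m≤n⇒m⊓n≡m j≤b) (sym (ℕP.m≤n⇒m⊓n≡m (ℕP.m≤n⇒m≤1+n j≤b)))) ⟩
    range (suc i) (j ⊓ suc b)                     ∎
    where j≤b = ℕP.≤-pred (ℕP.≰⇒> 1+b≰j)
  last (yes 1+b≤j) (yes i<1+b) = begin
    range (suc i) (j ⊓ b) ++ filter P? [ suc b ]
      ≡⟨ cong₂ (λ m l → range (suc i) m ++ l) (ℕP.m≥n⇒m⊓n≡n (ℕP.<⇒≤ 1+b≤j)) (ListP.filter-accept P? (i<1+b , 1+b≤j)) ⟩
    range (suc i) b ++ [ suc b ]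
      ≡⟨ range-∷ʳ (suc i) b i<1+b ⟨
    range (suc i) (suc b)
      ≡⟨ cong (range (suc i)) (ℕP.m≥n⇒m⊓n≡n 1+b≤j) ⟨
    range (suc i) (j ⊓ suc b)                     ∎
  last (yes 1+b≤j) (no i≮1+b) = begin
    range (suc i) (j ⊓ b) ++ filter P? [ suc b ]
      ≡⟨ cong₂ (λ m l → range (suc i) m ++ l) (ℕP.m≥n⇒m⊓n≡n (ℕP.<⇒≤ 1+b≤j)) (ListP.filter-reject P? (i≮1+b ∘ proj₁)) ⟩
    range (suc i) b ++ []
      ≡⟨ ListP.++-identityʳ _ ⟩
    range (suc i) b
      ≡⟨ range-empty (suc i) b (ℕP.m≤n⇒m≤1+n 1+b≤i) ⟩
    []
      ≡⟨ range-empty (suc i) (suc b) (s≤s 1+b≤i) ⟨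
    range (suc i) (suc b)
      ≡⟨ cong (range (suc i)) (ℕP.m≥n⇒m⊓n≡n 1+b≤j) ⟨
    range (suc i) (j ⊓ suc b)                     ∎
    where 1+b≤i = ℕP.≮⇒≥ i≮1+b

-- Words and presentations

invL-involutive : ∀ {G : Set} (x : Letter G) → invL (invL x) ≡ x
invL-involutive (g , b) = cong (g ,_) (BoolP.not-involutive b)

invW-∷ : ∀ {G : Set} (x : Letter G) w → invW (x ∷ w) ≡ invW w ++ [ invL x ]
invW-∷ x w = ListP.reverse-++ [ invL x ] (map invL w)

invW-involutive : ∀ {G : Set} (w : Word G) → invW (invW w) ≡ w
invW-involutive w = begin
  reverse (map invL (reverse (map invL w)))  ≡⟨ cong reverse (ListP.reverse-map invL (map invL w)) ⟩
  reverse (reverse (map invL (map invL w)))  ≡⟨ ListP.reverse-involutive (map invL (map invL w)) ⟩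
  map invL (map invL w)                      ≡⟨ ListP.map-∘ w ⟨
  map (λ x → invL (invL x)) w                ≡⟨ ListP.map-cong invL-involutive w ⟩
  map (λ x → x) w                            ≡⟨ ListP.map-id w ⟩
  w                                          ∎
  where open ≡-Reasoning

reverse-replicate : ∀ {A : Set} n (x : A) → reverse (replicate n x) ≡ replicate n x
reverse-replicate zero x = refl
reverse-replicate (suc n) x = begin
  reverse (x ∷ replicate n x)   ≡⟨ ListP.unfold-reverse x (replicate n x) ⟩
  reverse (replicate n x) ++ [ x ] ≡⟨ cong (_++ [ x ]) (reverse-replicate n x) ⟩
  replicate n x ++ [ x ]        ≡⟨ replicate-∷ʳ n ⟩
  x ∷ replicate n x             ∎
  where
  open ≡-Reasoning
  replicate-∷ʳ : ∀ n → replicate n x ++ [ x ] ≡ x ∷ replicate n x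
  replicate-∷ʳ zero = refl
  replicate-∷ʳ (suc n) = cong (x ∷_) (replicate-∷ʳ n)

pow-neg : ∀ {G : Set} (g : G) z → pow g (ℤ.- z) ≡ invW (pow g z)
pow-neg g (+ zero) = refl
pow-neg g (+ suc n) = sym (trans (cong reverse (ListP.map-replicate invL (suc n) (g , false))) (reverse-replicate (suc n) (g , true)))
pow-neg g -[1+ n ] = sym (trans (cong reverse (ListP.map-replicate invL (suc n) (g , true))) (reverse-replicate (suc n) (g , false)))

module Presentation {G : Set} (R : Word G → Set) where

  infix 4 _≈_
  _≈_ : Word G → Word G → Set
  u ≈ v = u ≈[ R ] v

  ≈-setoid : Setoid _ _
  ≈-setoid = EqClosure.setoid (Step R)

  open Setoid ≈-setoid public using () renaming (refl to ≈-refl; sym to ≈-sym; trans to ≈-trans; reflexive to ≈-reflexive)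
  module ≈-Reasoning = SetoidReasoning ≈-setoid

  step : ∀ {u v} → Step R u v → u ≈ v
  step = EqClosure.return

  ++-congˡ : ∀ w {u v} → u ≈ v → w ++ u ≈ w ++ v
  ++-congˡ w = EqClosure.gmap (w ++_) prefix
    where
    prefix : ∀ {u v} → Step R u v → Step R (w ++ u) (w ++ v)
    prefix (cancel u v x)   = subst₂ (Step R) (ListP.++-assoc w u _) (ListP.++-assoc w u v) (cancel (w ++ u) v x)
    prefix (delrel u v r p) = subst₂ (Step R) (ListP.++-assoc w u _) (ListP.++-assoc w u v) (delrel (w ++ u) v r p)

  ++-congʳ : ∀ w {u v} → u ≈ v → u ++ w ≈ v ++ w
  ++-congʳ w = EqClosure.gmap (_++ w) suffix
    where
    suffix : ∀ {u v} → Step R u v → Step R (u ++ w) (v ++ w)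
    suffix (cancel u v x)   = subst₂ (Step R) (sym (ListP.++-assoc u _ w)) (sym (ListP.++-assoc u v w)) (cancel u (v ++ w) x)
    suffix (delrel u v r p) = subst₂ (Step R) (sym (trans (ListP.++-assoc u (r ++ v) w) (cong (u ++_) (ListP.++-assoc r v w))))
                                              (sym (ListP.++-assoc u v w)) (delrel u (v ++ w) r p)

  ++-cong : ∀ {u u' v v'} → u ≈ u' → v ≈ v' → u ++ v ≈ u' ++ v'
  ++-cong {u' = u'} {v = v} u≈u' v≈v' = ≈-trans (++-congʳ v u≈u') (++-congˡ u' v≈v')

  ∷-cong : ∀ x {u v} → u ≈ v → x ∷ u ≈ x ∷ v
  ∷-cong x = ++-congˡ [ x ]

  ∷-invL-∷-cancel : ∀ x w → x ∷ invL x ∷ w ≈ w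
  ∷-invL-∷-cancel x w = step (cancel [] w x)

  relator≈[] : ∀ {r} → R r → r ≈ []
  relator≈[] {r} r∈R = step (subst₂ (Step R) (ListP.++-identityʳ r) refl (delrel [] [] r r∈R))

  ++-invW≈[] : ∀ w → w ++ invW w ≈ []
  ++-invW≈[] [] = ≈-refl
  ++-invW≈[] (x ∷ w) = begin
    x ∷ w ++ invW (x ∷ w)          ≡⟨ cong (λ v → x ∷ w ++ v) (invW-∷ x w) ⟩
    x ∷ w ++ invW w ++ [ invL x ]  ≡⟨ cong (x ∷_) (ListP.++-assoc w (invW w) [ invL x ]) ⟨
    x ∷ (w ++ invW w) ++ [ invL x ] ≈⟨ ∷-cong x (++-congʳ [ invL x ] (++-invW≈[] w)) ⟩
    x ∷ invL x ∷ []                ≈⟨ ∷-invL-∷-cancel x [] ⟩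
    []                             ∎
    where open ≈-Reasoning

  ++≈⇒≈-++-invW : ∀ {u v w} → u ++ v ≈ w → u ≈ w ++ invW v
  ++≈⇒≈-++-invW {u} {v} {w} uv≈w = begin
    u                      ≡⟨ ListP.++-identityʳ u ⟨
    u ++ []                ≈⟨ ++-congˡ u (++-invW≈[] v) ⟨
    u ++ v ++ invW v       ≡⟨ ListP.++-assoc u v (invW v) ⟨
    (u ++ v) ++ invW v     ≈⟨ ++-congʳ (invW v) uv≈w ⟩
    w ++ invW v            ∎
    where open ≈-Reasoning

  pow-suc : ∀ g z → pow g (ℤ.suc z) ≈ (g , false) ∷ pow g z
  pow-suc g (+ n)         = ≈-refl
  pow-suc g -[1+ zero ]   = ≈-sym (∷-invL-∷-cancel (g , false) [])
  pow-suc g -[1+ suc n ]  = ≈-sym (∷-invL-∷-cancel (g , false) (replicate (suc n) (g , true)))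

  pow-pred : ∀ g z → pow g (ℤ.pred z) ≈ (g , true) ∷ pow g z
  pow-pred g -[1+ n ]   = ≈-refl
  pow-pred g (+ zero)   = ≈-refl
  pow-pred g (+ suc n)  = ≈-sym (∷-invL-∷-cancel (g , true) (replicate n (g , false)))

  pow-+ : ∀ g a b → pow g a ++ pow g b ≈ pow g (a ℤ.+ b)
  pow-+ g (+ zero) b = ≈-reflexive (cong (pow g) (sym (ℤP.+-identityˡ b)))
  pow-+ g (+ suc m) b = begin
    (g , false) ∷ pow g (+ m) ++ pow g b  ≈⟨ ∷-cong (g , false) (pow-+ g (+ m) b) ⟩
    (g , false) ∷ pow g (+ m ℤ.+ b)       ≈⟨ pow-suc g (+ m ℤ.+ b) ⟨
    pow g (ℤ.suc (+ m ℤ.+ b))             ≡⟨ cong (pow g) (ℤP.+-assoc (+ 1) (+ m) b) ⟨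
    pow g (+ suc m ℤ.+ b)                 ∎
    where open ≈-Reasoning
  pow-+ g -[1+ zero ] b = ≈-sym (pow-pred g b)
  pow-+ g -[1+ suc m ] b = begin
    (g , true) ∷ pow g -[1+ m ] ++ pow g b  ≈⟨ ∷-cong (g , true) (pow-+ g -[1+ m ] b) ⟩
    (g , true) ∷ pow g (-[1+ m ] ℤ.+ b)     ≈⟨ pow-pred g (-[1+ m ] ℤ.+ b) ⟨
    pow g (ℤ.pred (-[1+ m ] ℤ.+ b))         ≡⟨ cong (pow g) (ℤP.+-assoc (ℤ.- + 1) -[1+ m ] b) ⟨
    pow g (-[1+ suc m ] ℤ.+ b)              ∎
    where open ≈-Reasoning

module LetterAction {G X : Set} (actL : Letter G → X → X) where

  act : Word G → X → X
  act []      s = s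
  act (x ∷ w) s = act w (actL x s)

  act-++ : ∀ v w s → act (v ++ w) s ≡ act w (act v s)
  act-++ []      w s = refl
  act-++ (x ∷ v) w s = act-++ v w (actL x s)

  module _ (Good : X → Set) (actL-good : ∀ x {s} → Good s → Good (actL x s)) where

    act-good : ∀ w {s} → Good s → Good (act w s)
    act-good []      good = good
    act-good (x ∷ w) good = act-good w (actL-good x good)

    act-respects-≈ : ∀ {R : Word G → Set} →
                     (∀ x {s} → Good s → act (x ∷ invL x ∷ []) s ≡ s) →
                     (∀ {r} → R r → ∀ {s} → Good s → act r s ≡ s) →
                     ∀ {u v} → u ≈[ R ] v → ∀ {s} → Good s → act u s ≡ act v s
    act-respects-≈ {R} cancel-trivial relator-trivial = EqClosure.fold agree-isEquivalence agree-step
      where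
      Agree : Word G → Word G → Set
      Agree u v = ∀ {s} → Good s → act u s ≡ act v s
      agree-isEquivalence : IsEquivalence Agree
      agree-isEquivalence = record
        { refl  = λ _ → refl
        ; sym   = λ u~v good → sym (u~v good)
        ; trans = λ u~v v~w good → trans (u~v good) (v~w good)
        }
      insert-trivial : ∀ v w v' → (∀ {s} → Good s → act w s ≡ s) → Agree (v ++ w ++ v') (v ++ v')
      insert-trivial v w v' w-trivial {s} good = begin
        act (v ++ w ++ v') s       ≡⟨ act-++ v (w ++ v') s ⟩
        act (w ++ v') (act v s)    ≡⟨ act-++ w v' (act v s) ⟩
        act v' (act w (act v s))   ≡⟨ cong (act v') (w-trivial (act-good v good)) ⟩
        act v' (act v s)           ≡⟨ act-++ v v' s ⟨
        act (v ++ v') s            ∎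
        where open ≡-Reasoning
      agree-step : ∀ {u v} → Step R u v → Agree u v
      agree-step (cancel v v' x)   = insert-trivial v (x ∷ invL x ∷ []) v' (cancel-trivial x)
      agree-step (delrel v v' w r) = insert-trivial v w v' (relator-trivial r)

module FreeReduction {S : Set} (_≟_ : DecidableEquality S) (inv : S → S) (inv-involutive : ∀ x → inv (inv x) ≡ x) where

  pushBy : {A : Set} → (A → S) → A → List A → List A
  pushBy f q [] = [ q ]
  pushBy f q (p ∷ ps) with f q ≟ inv (f p)
  ... | yes _ = ps
  ... | no _  = q ∷ p ∷ ps

  pushAllBy : {A : Set} → (A → S) → List A → List A → List A
  pushAllBy f acc []       = acc
  pushAllBy f acc (q ∷ qs) = pushAllBy f (pushBy f q acc) qs

  pushAllBy-∷ʳ : ∀ {A : Set} (f : A → S) acc qs q → pushAllBy f acc (qs ++ [ q ]) ≡ pushBy f q (pushAllBy f acc qs)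
  pushAllBy-∷ʳ f acc []       q = refl
  pushAllBy-∷ʳ f acc (p ∷ qs) q = pushAllBy-∷ʳ f (pushBy f p acc) qs q

  map-pushBy : ∀ {A B : Set} (g : A → B) (f : B → S) q ps → map g (pushBy (f ∘ g) q ps) ≡ pushBy f (g q) (map g ps)
  map-pushBy g f q [] = refl
  map-pushBy g f q (p ∷ ps) with f (g q) ≟ inv (f (g p))
  ... | yes _ = refl
  ... | no _  = refl

  map-pushAllBy : ∀ {A B : Set} (g : A → B) (f : B → S) acc qs →
                  map g (pushAllBy (f ∘ g) acc qs) ≡ pushAllBy f (map g acc) (map g qs)
  map-pushAllBy g f acc []       = refl
  map-pushAllBy g f acc (q ∷ qs) = trans (map-pushAllBy g f (pushBy (f ∘ g) q acc) qs)
                                         (cong (λ acc' → pushAllBy f acc' (map g qs)) (map-pushBy g f q acc))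

  push : S → List S → List S
  push = pushBy id

  pushAll : List S → List S → List S
  pushAll = pushAllBy id

  Reduced : List S → Set
  Reduced = Linked (λ x y → x ≢ inv y)

  push-reduced : ∀ x {u} → Reduced u → Reduced (push x u)
  push-reduced x {[]}    _ = [-]
  push-reduced x {y ∷ u} r with x ≟ inv y
  ... | yes _ = Linked.tail r
  ... | no  x≢y⁻¹ = x≢y⁻¹ ∷ r

  push-inv-push : ∀ x {u} → Reduced u → push (inv x) (push x u) ≡ u
  push-inv-push x {[]} _ with inv x ≟ inv x
  ... | yes _ = refl
  ... | no ne = contradiction refl ne
  push-inv-push x {y ∷ u} r with x ≟ inv y
  push-inv-push x {y ∷ []}    r       | yes refl rewrite inv-involutive y = refl
  push-inv-push x {y ∷ z ∷ u} (y≢z⁻¹ ∷ _) | yes refl rewrite inv-involutive y with y ≟ inv z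
  ... | yes y≡z⁻¹ = contradiction y≡z⁻¹ y≢z⁻¹
  ... | no _ = refl
  push-inv-push x {y ∷ u} r | no _ with inv x ≟ inv x
  ... | yes _ = refl
  ... | no ne = contradiction refl ne

  push-push-inv : ∀ x {u} → Reduced u → push x (push (inv x) u) ≡ u
  push-push-inv x {u} r = subst (λ x' → push x' (push (inv x) u) ≡ u) (inv-involutive x) (push-inv-push (inv x) r)

module Conjugation (𝒢 : GBSGraph) where
  open GBSGraph 𝒢
  open Presentation Relator

  conj : Fin nE → Word Gen → Word Gen
  conj e v = (edg e , false) ∷ v ++ [ (edg (bar e) , false) ]

  conj-[] : ∀ e → conj e [] ≈ []
  conj-[] e = subst (λ e' → (edg e' , false) ∷ (edg (bar e) , false) ∷ [] ≈ []) (bar-invol e) (relator≈[] (r-bar (bar e)))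

  conj-++ : ∀ e u v → conj e (u ++ v) ≈ conj e u ++ conj e v
  conj-++ e u v = begin
    (edg e , false) ∷ (u ++ v) ++ [ ē ]                   ≡⟨ cong ((edg e , false) ∷_) (ListP.++-assoc u v [ ē ]) ⟩
    (edg e , false) ∷ u ++ [] ++ v ++ [ ē ]               ≈⟨ ∷-cong (edg e , false) (++-congˡ u (++-congʳ (v ++ [ ē ]) (relator≈[] (r-bar e)))) ⟨
    (edg e , false) ∷ u ++ (ē ∷ (edg e , false) ∷ []) ++ v ++ [ ē ] ≡⟨ cong ((edg e , false) ∷_) (ListP.++-assoc u [ ē ] _) ⟨
    conj e u ++ conj e v                                  ∎
    where
    open ≈-Reasoning
    ē = (edg (bar e) , false)

  conj-cong : ∀ e {u v} → u ≈ v → conj e u ≈ conj e v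
  conj-cong e u≈v = ∷-cong (edg e , false) (++-congʳ [ (edg (bar e) , false) ] u≈v)

  conj-τ^β : ∀ e → conj e (pow (vtx (τ e)) (β e)) ≈ pow (vtx (ι e)) (α e)
  conj-τ^β e = subst (conj e (pow (vtx (τ e)) (β e)) ≈_) (invW-involutive (pow (vtx (ι e)) (α e)))
    (++≈⇒≈-++-invW (≈-trans (≈-reflexive (cong ((edg e , false) ∷_) (ListP.++-assoc (pow (vtx (τ e)) (β e)) [ (edg (bar e) , false) ] _)))
                            (relator≈[] (r-bs e))))

  conj-τ^βn : ∀ e n → conj e (pow (vtx (τ e)) (β e ℤ.* + n)) ≈ pow (vtx (ι e)) (α e ℤ.* + n)
  conj-τ^βn e zero = subst₂ (λ b a → conj e (pow (vtx (τ e)) b) ≈ pow (vtx (ι e)) a)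
                            (sym (ℤP.*-zeroʳ (β e))) (sym (ℤP.*-zeroʳ (α e))) (conj-[] e)
  conj-τ^βn e (suc n) = begin
    conj e (pow τ' (β e ℤ.* + suc n))                        ≡⟨ cong (conj e ∘ pow τ') (ℤP.*-suc (β e) (+ n)) ⟩
    conj e (pow τ' (β e ℤ.+ β e ℤ.* + n))                    ≈⟨ conj-cong e (pow-+ τ' (β e) (β e ℤ.* + n)) ⟨
    conj e (pow τ' (β e) ++ pow τ' (β e ℤ.* + n))            ≈⟨ conj-++ e (pow τ' (β e)) (pow τ' (β e ℤ.* + n)) ⟩
    conj e (pow τ' (β e)) ++ conj e (pow τ' (β e ℤ.* + n))   ≈⟨ ++-cong (conj-τ^β e) (conj-τ^βn e n) ⟩
    pow ι' (α e) ++ pow ι' (α e ℤ.* + n)                     ≈⟨ pow-+ ι' (α e) (α e ℤ.* + n) ⟩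
    pow ι' (α e ℤ.+ α e ℤ.* + n)                             ≡⟨ cong (pow ι') (ℤP.*-suc (α e) (+ n)) ⟨
    pow ι' (α e ℤ.* + suc n)                                 ∎
    where
    open ≈-Reasoning
    τ' = vtx (τ e)
    ι' = vtx (ι e)

  conj-τ^βm : ∀ e m → conj e (pow (vtx (τ e)) (β e ℤ.* m)) ≈ pow (vtx (ι e)) (α e ℤ.* m)
  conj-τ^βm e (+ n) = conj-τ^βn e n
  conj-τ^βm e -[1+ n ] = subst₂ (λ b a → conj e (pow τ' b) ≈ pow ι' a) (ℤP.neg-distribʳ-* (β e) (+ suc n)) (ℤP.neg-distribʳ-* (α e) (+ suc n))
    (subst (conj e (pow τ' (ℤ.- B)) ≈_) (sym (pow-neg ι' A)) (++≈⇒≈-++-invW cancels))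
    where
    open ≈-Reasoning
    τ' = vtx (τ e)
    ι' = vtx (ι e)
    B = β e ℤ.* + suc n
    A = α e ℤ.* + suc n
    cancels : conj e (pow τ' (ℤ.- B)) ++ pow ι' A ≈ []
    cancels = begin
      conj e (pow τ' (ℤ.- B)) ++ pow ι' A              ≈⟨ ++-congˡ (conj e (pow τ' (ℤ.- B))) (conj-τ^βn e (suc n)) ⟨
      conj e (pow τ' (ℤ.- B)) ++ conj e (pow τ' B)     ≈⟨ conj-++ e (pow τ' (ℤ.- B)) (pow τ' B) ⟨
      conj e (pow τ' (ℤ.- B) ++ pow τ' B)              ≈⟨ conj-cong e (pow-+ τ' (ℤ.- B) B) ⟩
      conj e (pow τ' (ℤ.- B ℤ.+ B))                    ≡⟨ cong (conj e ∘ pow τ') (ℤP.+-inverseˡ B) ⟩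
      conj e []                                        ≈⟨ conj-[] e ⟩
      []                                               ∎

  merge-word : ∀ {v₁ v₂ v₃ e'} e m₁ z m₂ → v₁ ≡ ι e → v₂ ≡ τ e → e' ≡ bar e → v₃ ≡ ι e →
    pow (vtx v₁) m₁ ++ (edg e , false) ∷ (pow (vtx v₂) (β e ℤ.* z) ++ (edg e' , false) ∷ pow (vtx v₃) m₂)
      ≈ pow (vtx v₁) (m₁ ℤ.+ (α e ℤ.* z ℤ.+ m₂))
  merge-word e m₁ z m₂ refl refl refl refl = begin
    ι^ m₁ ++ (edg e , false) ∷ (pow (vtx (τ e)) (β e ℤ.* z) ++ (edg (bar e) , false) ∷ ι^ m₂)
      ≡⟨ cong (λ v → ι^ m₁ ++ (edg e , false) ∷ v) (ListP.++-assoc (pow (vtx (τ e)) (β e ℤ.* z)) [ (edg (bar e) , false) ] (ι^ m₂)) ⟨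
    ι^ m₁ ++ conj e (pow (vtx (τ e)) (β e ℤ.* z)) ++ ι^ m₂    ≈⟨ ++-congˡ (ι^ m₁) (++-congʳ (ι^ m₂) (conj-τ^βm e z)) ⟩
    ι^ m₁ ++ ι^ (α e ℤ.* z) ++ ι^ m₂                         ≈⟨ ++-congˡ (ι^ m₁) (pow-+ (vtx (ι e)) (α e ℤ.* z) m₂) ⟩
    ι^ m₁ ++ ι^ (α e ℤ.* z ℤ.+ m₂)                          ≈⟨ pow-+ (vtx (ι e)) m₁ (α e ℤ.* z ℤ.+ m₂) ⟩
    ι^ (m₁ ℤ.+ (α e ℤ.* z ℤ.+ m₂))                          ∎
    where
    open ≈-Reasoning
    ι^ = pow (vtx (ι e))

-- Defs' ρE takes a factorization that it never inspects; the action depends on 𝒢 and D only.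
module Action (𝒢 : GBSGraph) (D : GBSGraph.Orientation 𝒢) (f : Factorization 𝒢) where
  open GBSGraph 𝒢
  open GBSGraph.Orientation D
  open MonoidSum ℚP.*-1-commutativeMonoid using (sum-cong-≗; sum-replicate-zero) renaming (sum to ∏)

  Level : Set
  Level = Vec ℤ nE

  _⊕_ : Level → Level → Level
  _⊕_ = zipWith ℤ._+_

  ρ : Fin nE → Level
  ρ e = Vec.tabulate (ρE 𝒢 D f e)

  lookup-⊕ρ : ∀ l e d → lookup (l ⊕ ρ e) d ≡ lookup l d ℤ.+ ρE 𝒢 D f e d
  lookup-⊕ρ l e d = trans (VecP.lookup-zipWith ℤ._+_ d l (ρ e)) (cong (λ x → lookup l d ℤ.+ x) (VecP.lookup∘tabulate (ρE 𝒢 D f e) d))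

  level-ext : ∀ {l l' : Level} → (∀ d → lookup l d ≡ lookup l' d) → l ≡ l'
  level-ext {l} {l'} eq = trans (sym (VecP.tabulate∘lookup l)) (trans (VecP.tabulate-cong eq) (VecP.tabulate∘lookup l'))

  rep : Fin nE → Fin nE
  rep e = if inD e then e else bar e

  sgn : Fin nE → ℤ
  sgn e = if inD e then + 1 else -[1+ 0 ]

  ρE-rep : ∀ e → ρE 𝒢 D f e (rep e) ≡ sgn e
  ρE-rep e with inD e in e∈D
  ... | true rewrite e∈D with e Fin.≟ e
  ...   | yes _ = refl
  ...   | no e≢e = contradiction refl e≢e
  ρE-rep e | false rewrite inD-bar e | e∈D with e Fin.≟ bar e | e Fin.≟ bar (bar e)
  ...   | yes e≡ē | _ = contradiction (sym e≡ē) (bar-fpf e)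
  ...   | no _ | yes _ = refl
  ...   | no _ | no e≢ē̄ = contradiction (sym (bar-invol e)) e≢ē̄

  rep-∈D : ∀ {e} → inD e ≡ true → rep e ≡ e
  rep-∈D {e} = cong (if_then e else bar e)

  rep-∉D : ∀ {e} → inD e ≡ false → rep e ≡ bar e
  rep-∉D {e} = cong (if_then e else bar e)

  ρE-≢rep : ∀ e d → d ≢ rep e → ρE 𝒢 D f e d ≡ + 0
  ρE-≢rep e d d≢rep with inD d in d∈D
  ... | false = refl
  ... | true with e Fin.≟ d | e Fin.≟ bar d
  ...   | yes refl | _ = contradiction (sym (rep-∈D d∈D)) d≢rep
  ...   | no _ | yes refl = contradiction (sym (trans (rep-∉D (trans (inD-bar d) (cong not d∈D))) (bar-invol d))) d≢rep
  ...   | no _ | no _ = refl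

  rep-bar : ∀ e → rep (bar e) ≡ rep e
  rep-bar e rewrite inD-bar e with inD e
  ... | true  = bar-invol e
  ... | false = refl

  sgn-+-sgn-bar : ∀ e → sgn e ℤ.+ sgn (bar e) ≡ + 0
  sgn-+-sgn-bar e rewrite inD-bar e with inD e
  ... | true  = refl
  ... | false = refl

  ρE-+-ρE-bar : ∀ e d → ρE 𝒢 D f e d ℤ.+ ρE 𝒢 D f (bar e) d ≡ + 0
  ρE-+-ρE-bar e d with d Fin.≟ rep e
  ... | yes refl = trans (cong₂ ℤ._+_ (ρE-rep e) (subst (λ x → ρE 𝒢 D f (bar e) x ≡ sgn (bar e)) (rep-bar e) (ρE-rep (bar e))))
                         (sgn-+-sgn-bar e)
  ... | no d≢rep = cong₂ ℤ._+_ (ρE-≢rep e d d≢rep) (ρE-≢rep (bar e) d (λ eq → d≢rep (trans eq (rep-bar e))))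

  ⊕ρ-⊕ρ-bar : ∀ l e → (l ⊕ ρ e) ⊕ ρ (bar e) ≡ l
  ⊕ρ-⊕ρ-bar l e = level-ext λ d → begin
    lookup ((l ⊕ ρ e) ⊕ ρ (bar e)) d                        ≡⟨ lookup-⊕ρ (l ⊕ ρ e) (bar e) d ⟩
    lookup (l ⊕ ρ e) d ℤ.+ ρE 𝒢 D f (bar e) d              ≡⟨ cong (ℤ._+ ρE 𝒢 D f (bar e) d) (lookup-⊕ρ l e d) ⟩
    lookup l d ℤ.+ ρE 𝒢 D f e d ℤ.+ ρE 𝒢 D f (bar e) d     ≡⟨ ℤP.+-assoc (lookup l d) _ _ ⟩
    lookup l d ℤ.+ (ρE 𝒢 D f e d ℤ.+ ρE 𝒢 D f (bar e) d)   ≡⟨ cong (λ x → lookup l d ℤ.+ x) (ρE-+-ρE-bar e d) ⟩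
    lookup l d ℤ.+ + 0                                      ≡⟨ ℤP.+-identityʳ (lookup l d) ⟩
    lookup l d                                              ∎
    where open ≡-Reasoning

  r : Fin nE → ℚ
  r e = ratio (α e) (β e)

  α-bar : ∀ e → α (bar e) ≡ β e
  α-bar e = trans (α-β-bar (bar e)) (cong β (bar-invol e))

  β-bar : ∀ e → β (bar e) ≡ α e
  β-bar e = sym (α-β-bar e)

  r-bar*r : ∀ e → r (bar e) * r e ≡ 1ℚ
  r-bar*r e rewrite α-bar e | β-bar e = ratio-*-ratio (β-nz e) (α-nz e)

  r≢0 : ∀ e → r e ≢ 0ℚ
  r≢0 e = ratio≢0 (α-nz e) (β-nz e)

  β*r : ∀ e → fromℤ (β e) * r e ≡ fromℤ (α e)
  β*r e = fromℤ-*-ratio (α e) (β-nz e)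

  rpow : Fin nE → ℤ → ℚ
  rpow d = powℤ (r d) (r (bar d))

  σ : Level → ℚ
  σ l = ∏ (λ d → rpow d (lookup l d))

  rpow-rep : ∀ e z → rpow (rep e) (z ℤ.+ sgn e) ≡ rpow (rep e) z * r e
  rpow-rep e z with inD e
  ... | true  = trans (cong (rpow e) (ℤP.+-comm z (+ 1))) (powℤ-suc (r-bar*r e) z)
  ... | false = trans (cong (rpow (bar e)) (ℤP.+-comm z -[1+ 0 ]))
                      (trans (powℤ-pred (r-bar*r (bar e)) z) (cong (λ x → rpow (bar e) z * r x) (bar-invol e)))

  σ-⊕ρ : ∀ l e → σ (l ⊕ ρ e) ≡ σ l * r e
  σ-⊕ρ l e = sum-agree-except ℚP.*-1-commutativeMonoid _ _ (rep e) (r e) unchanged changed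
    where
    unchanged : ∀ d → d ≢ rep e → rpow d (lookup (l ⊕ ρ e) d) ≡ rpow d (lookup l d)
    unchanged d d≢rep = cong (rpow d) (trans (lookup-⊕ρ l e d)
      (trans (cong (λ x → lookup l d ℤ.+ x) (ρE-≢rep e d d≢rep)) (ℤP.+-identityʳ (lookup l d))))
    changed : rpow (rep e) (lookup (l ⊕ ρ e) (rep e)) ≡ rpow (rep e) (lookup l (rep e)) * r e
    changed = trans (cong (rpow (rep e)) (trans (lookup-⊕ρ l e (rep e)) (cong (λ x → lookup l (rep e) ℤ.+ x) (ρE-rep e))))
                    (rpow-rep e (lookup l (rep e)))

  σ-0 : σ (Vec.replicate nE (+ 0)) ≡ 1ℚ
  σ-0 = trans (sum-cong-≗ (λ d → cong (rpow d) (VecP.lookup-replicate d (+ 0)))) (sum-replicate-zero nE)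

  record Point : Set where
    constructor ⟨_,_,_⟩
    field
      level    : Level
      position : ℚ
      scale    : ℚ
  open Point public

  ⟨,,⟩-cong : ∀ {l l' T T' s s'} → l ≡ l' → T ≡ T' → s ≡ s' → ⟨ l , T , s ⟩ ≡ ⟨ l' , T' , s' ⟩
  ⟨,,⟩-cong refl refl refl = refl

  translate : ℤ → Point → Point
  translate z ⟨ l , T , s ⟩ = ⟨ l , T + fromℤ z * s , s ⟩

  traverse : Fin nE → Point → Point
  traverse e ⟨ l , T , s ⟩ = ⟨ l ⊕ ρ e , T , s * r e ⟩

  Symbol : Set
  Symbol = Fin nE × Level × ℚ

  symbol : Fin nE → Point → Symbol
  symbol e ⟨ l , T , s ⟩ = e , l , T mod (fromℤ (α e) * s)

  inverse : Symbol → Symbol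
  inverse (e , l , R) = bar e , l ⊕ ρ e , R

  inverse-involutive : ∀ x → inverse (inverse x) ≡ x
  inverse-involutive (e , l , R) rewrite bar-invol e | ⊕ρ-⊕ρ-bar l e = refl

  _≟ˢ_ : DecidableEquality Symbol
  _≟ˢ_ = ×P.≡-dec Fin._≟_ (×P.≡-dec (VecP.≡-dec ℤP._≟_) ℚP._≟_)

  translate-+ : ∀ a b h → translate a (translate b h) ≡ translate (b ℤ.+ a) h
  translate-+ a b ⟨ l , T , s ⟩ = cong (λ T' → ⟨ l , T' , s ⟩) (begin
    T + fromℤ b * s + fromℤ a * s        ≡⟨ solve 4 (λ T b a s → T :+ b :* s :+ a :* s := T :+ (b :+ a) :* s) refl T (fromℤ b) (fromℤ a) s ⟩
    T + (fromℤ b + fromℤ a) * s          ≡⟨ cong (λ x → T + x * s) (fromℤ-+ b a) ⟨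
    T + fromℤ (b ℤ.+ a) * s              ∎)
    where open ≡-Reasoning

  translate-0 : ∀ h → translate (+ 0) h ≡ h
  translate-0 ⟨ l , T , s ⟩ = cong (λ T' → ⟨ l , T' , s ⟩) (solve 2 (λ T s → T :+ con 0ℚ :* s := T) refl T s)

  translate-neg-translate : ∀ z h → translate (ℤ.- z) (translate z h) ≡ h
  translate-neg-translate z h = trans (translate-+ (ℤ.- z) z h) (trans (cong (λ x → translate x h) (ℤP.+-inverseʳ z)) (translate-0 h))

  β*[s*r] : ∀ e s → fromℤ (β e) * (s * r e) ≡ fromℤ (α e) * s
  β*[s*r] e s = trans (solve 3 (λ b s r → b :* (s :* r) := s :* (b :* r)) refl (fromℤ (β e)) s (r e))
                      (trans (cong (s *_) (β*r e)) (ℚP.*-comm s (fromℤ (α e))))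

  fromℤ[β*m]*[s*r] : ∀ e m s → fromℤ (β e ℤ.* m) * (s * r e) ≡ fromℤ (α e) * s * fromℤ m
  fromℤ[β*m]*[s*r] e m s = begin
    fromℤ (β e ℤ.* m) * (s * r e)          ≡⟨ cong (_* (s * r e)) (fromℤ-* (β e) m) ⟩
    fromℤ (β e) * fromℤ m * (s * r e)      ≡⟨ solve 4 (λ b m s r → b :* m :* (s :* r) := b :* (s :* r) :* m) refl (fromℤ (β e)) (fromℤ m) s (r e) ⟩
    fromℤ (β e) * (s * r e) * fromℤ m      ≡⟨ cong (_* fromℤ m) (β*[s*r] e s) ⟩
    fromℤ (α e) * s * fromℤ m              ∎
    where open ≡-Reasoning

  traverse-bar-translate-traverse : ∀ e m h → traverse (bar e) (translate (β e ℤ.* m) (traverse e h)) ≡ translate (α e ℤ.* m) h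
  traverse-bar-translate-traverse e m ⟨ l , T , s ⟩ = ⟨,,⟩-cong (⊕ρ-⊕ρ-bar l e) position-eq scale-eq
    where
    position-eq : T + fromℤ (β e ℤ.* m) * (s * r e) ≡ T + fromℤ (α e ℤ.* m) * s
    position-eq = cong (λ x → T + x) (trans (fromℤ[β*m]*[s*r] e m s)
      (trans (solve 3 (λ a s m → a :* s :* m := a :* m :* s) refl (fromℤ (α e)) s (fromℤ m)) (cong (_* s) (sym (fromℤ-* (α e) m)))))
    scale-eq : s * r e * r (bar e) ≡ s
    scale-eq = trans (ℚP.*-assoc s (r e) (r (bar e))) (trans (cong (s *_) (trans (ℚP.*-comm (r e) (r (bar e))) (r-bar*r e))) (ℚP.*-identityʳ s))

  symbol-bar-translate-traverse : ∀ e m h → symbol (bar e) (translate (β e ℤ.* m) (traverse e h)) ≡ inverse (symbol e h)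
  symbol-bar-translate-traverse e m ⟨ l , T , s ⟩ = cong (λ R → bar e , l ⊕ ρ e , R) (begin
    (T + fromℤ (β e ℤ.* m) * (s * r e)) mod (fromℤ (α (bar e)) * (s * r e))
      ≡⟨ cong₂ (λ x y → (T + x) mod (fromℤ y * (s * r e))) (fromℤ[β*m]*[s*r] e m s) (α-bar e) ⟩
    (T + fromℤ (α e) * s * fromℤ m) mod (fromℤ (β e) * (s * r e))
      ≡⟨ cong (λ M → (T + fromℤ (α e) * s * fromℤ m) mod M) (β*[s*r] e s) ⟩
    (T + fromℤ (α e) * s * fromℤ m) mod (fromℤ (α e) * s)
      ≡⟨ mod-periodic T (fromℤ (α e) * s) m ⟩
    T mod (fromℤ (α e) * s)
      ∎)
    where open ≡-Reasoning

  open FreeReduction _≟ˢ_ inverse inverse-involutive public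

  State : Set
  State = List Symbol × Point

  cross : Fin nE → State → State
  cross e (u , h) = push (symbol e h) u , traverse e h

  actL : Letter Gen → State → State
  actL (inj₁ _ , false) (u , h) = u , translate (+ 1) h
  actL (inj₁ _ , true)  (u , h) = u , translate -[1+ 0 ] h
  actL (inj₂ e , false) = cross e
  actL (inj₂ e , true)  = cross (bar e)

  open LetterAction actL public using (act; act-++)

  actL-reduced : ∀ x {st} → Reduced (proj₁ st) → Reduced (proj₁ (actL x st))
  actL-reduced (inj₁ _ , false) red = red
  actL-reduced (inj₁ _ , true)  red = red
  actL-reduced (inj₂ e , false) red = push-reduced _ red
  actL-reduced (inj₂ e , true)  red = push-reduced _ red

  act-pow : ∀ v z u h → act (pow (vtx v) z) (u , h) ≡ (u , translate z h)
  act-pow v (+ n) u h = act-replicate n h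
    where
    act-replicate : ∀ n h → act (replicate n (vtx v , false)) (u , h) ≡ (u , translate (+ n) h)
    act-replicate zero h = cong (u ,_) (sym (translate-0 h))
    act-replicate (suc n) h = trans (act-replicate n (translate (+ 1) h)) (cong (u ,_) (translate-+ (+ n) (+ 1) h))
  act-pow v -[1+ n ] u h = act-replicate n h
    where
    act-replicate : ∀ n h → act (replicate (suc n) (vtx v , true)) (u , h) ≡ (u , translate -[1+ n ] h)
    act-replicate zero h = refl
    act-replicate (suc n) h = trans (act-replicate n (translate -[1+ 0 ] h)) (cong (u ,_) (translate-+ -[1+ n ] -[1+ 0 ] h))

  cross-bar-translate-cross : ∀ e m {u} h → Reduced u →
    cross (bar e) (push (symbol e h) u , translate (β e ℤ.* m) (traverse e h)) ≡ (u , translate (α e ℤ.* m) h)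
  cross-bar-translate-cross e m {u} h red = cong₂ _,_
    (trans (cong (λ x → push x (push (symbol e h) u)) (symbol-bar-translate-traverse e m h)) (push-inv-push (symbol e h) red))
    (traverse-bar-translate-traverse e m h)

  cross-bar-cross : ∀ e {u} h → Reduced u → cross (bar e) (cross e (u , h)) ≡ (u , h)
  cross-bar-cross e {u} h red = begin
    cross (bar e) (push (symbol e h) u , traverse e h)                       ≡⟨ cong (λ x → cross (bar e) (push (symbol e h) u , x))
                                                                                    (translate-*0 (β e) (traverse e h)) ⟨
    cross (bar e) (push (symbol e h) u , translate (β e ℤ.* + 0) (traverse e h)) ≡⟨ cross-bar-translate-cross e (+ 0) h red ⟩
    (u , translate (α e ℤ.* + 0) h)                                          ≡⟨ cong (u ,_) (translate-*0 (α e) h) ⟩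
    (u , h)                                                                  ∎
    where
    open ≡-Reasoning
    translate-*0 : ∀ a h → translate (a ℤ.* + 0) h ≡ h
    translate-*0 a h = trans (cong (λ z → translate z h) (ℤP.*-zeroʳ a)) (translate-0 h)

  cross-cross-bar : ∀ e {u} h → Reduced u → cross e (cross (bar e) (u , h)) ≡ (u , h)
  cross-cross-bar e {u} h red = subst (λ e' → cross e' (cross (bar e) (u , h)) ≡ (u , h)) (bar-invol e) (cross-bar-cross (bar e) h red)

  act-cancel : ∀ x {st} → Reduced (proj₁ st) → act (x ∷ invL x ∷ []) st ≡ st
  act-cancel (inj₁ _ , false) {u , h} _   = cong (u ,_) (translate-neg-translate (+ 1) h)
  act-cancel (inj₁ _ , true)  {u , h} _   = cong (u ,_) (translate-neg-translate -[1+ 0 ] h)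
  act-cancel (inj₂ e , false) {u , h} red = cross-bar-cross e h red
  act-cancel (inj₂ e , true)  {u , h} red = cross-cross-bar e h red

  act-relator : ∀ {w} → Relator w → ∀ {st} → Reduced (proj₁ st) → act w st ≡ st
  act-relator (r-bar e) {u , h} red = cross-cross-bar e h red
  act-relator (r-bs e) {u , h} red = begin
    act (τ^β ++ (edg (bar e) , false) ∷ ι^-α) (cross e (u , h))
      ≡⟨ act-++ τ^β _ (cross e (u , h)) ⟩
    act ((edg (bar e) , false) ∷ ι^-α) (act τ^β (cross e (u , h)))
      ≡⟨ cong (act ((edg (bar e) , false) ∷ ι^-α)) (act-pow (τ e) (β e) u' h') ⟩
    act ι^-α (cross (bar e) (u' , translate (β e) h'))
      ≡⟨ cong (λ z → act ι^-α (cross (bar e) (u' , translate z h'))) (ℤP.*-identityʳ (β e)) ⟨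
    act ι^-α (cross (bar e) (u' , translate (β e ℤ.* + 1) h'))
      ≡⟨ cong (act ι^-α) (cross-bar-translate-cross e (+ 1) h red) ⟩
    act ι^-α (u , translate (α e ℤ.* + 1) h)
      ≡⟨ cong (λ z → act ι^-α (u , translate z h)) (ℤP.*-identityʳ (α e)) ⟩
    act ι^-α (u , translate (α e) h)
      ≡⟨ cong (λ w → act w (u , translate (α e) h)) (pow-neg (vtx (ι e)) (α e)) ⟨
    act (pow (vtx (ι e)) (ℤ.- α e)) (u , translate (α e) h)
      ≡⟨ act-pow (ι e) (ℤ.- α e) u _ ⟩
    (u , translate (ℤ.- α e) (translate (α e) h))
      ≡⟨ cong (u ,_) (translate-neg-translate (α e) h) ⟩
    (u , h)                                                               ∎
    where
    open ≡-Reasoning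
    τ^β = pow (vtx (τ e)) (β e)
    ι^-α = invW (pow (vtx (ι e)) (α e))
    u' = push (symbol e h) u
    h' = traverse e h

  act-≈F : ∀ {w w'} → w ≈F w' → ∀ {u} h → Reduced u → act w (u , h) ≡ act w' (u , h)
  act-≈F w≈w' h red = LetterAction.act-respects-≈ actL (Reduced ∘ proj₁) actL-reduced act-cancel act-relator w≈w' red

module Walk (𝒢 : GBSGraph) (D : GBSGraph.Orientation 𝒢) (f : Factorization 𝒢) where
  open GBSGraph 𝒢
  open GBSGraph.Orientation D
  open Factorization f
  open Action 𝒢 D f

  w : ℕ → ℕ → Word Gen
  w = wsub 𝒢 D f

  syllable : ℕ → Word Gen
  syllable μ = (edg (y μ) , false) ∷ pow (vtx (a μ)) (k μ)

  w-refl : ∀ i → w i i ≡ pow (vtx (a i)) (k i)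
  w-refl i = trans (cong (λ l → pow (vtx (a i)) (k i) ++ concatMap syllable l) (range-empty (suc i) i ℕP.≤-refl))
                   (ListP.++-identityʳ _)

  w-∷ʳ : ∀ {i t} → i ≤ t → w i (suc t) ≡ w i t ++ syllable (suc t)
  w-∷ʳ {i} {t} i≤t = begin
    a^k ++ concatMap syllable (range (suc i) (suc t))
      ≡⟨ cong (λ l → a^k ++ concatMap syllable l) (range-∷ʳ (suc i) t (s≤s i≤t)) ⟩
    a^k ++ concatMap syllable (range (suc i) t ++ [ suc t ])
      ≡⟨ cong (a^k ++_) (ListP.concatMap-++ syllable (range (suc i) t) [ suc t ]) ⟩
    a^k ++ (concatMap syllable (range (suc i) t) ++ syllable (suc t) ++ [])
      ≡⟨ cong (λ v → a^k ++ (concatMap syllable (range (suc i) t) ++ v)) (ListP.++-identityʳ _) ⟩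
    a^k ++ (concatMap syllable (range (suc i) t) ++ syllable (suc t))
      ≡⟨ ListP.++-assoc a^k _ _ ⟨
    w i t ++ syllable (suc t)
      ∎
    where
    open ≡-Reasoning
    a^k = pow (vtx (a i)) (k i)

  w-split : ∀ {i p j} → i ≤ p → suc p ≤′ j → w i j ≡ w i p ++ (edg (y (suc p)) , false) ∷ w (suc p) j
  w-split {i} {p} i≤p ≤′-refl = trans (w-∷ʳ i≤p) (cong (λ v → w i p ++ (edg (y (suc p)) , false) ∷ v) (sym (w-refl (suc p))))
  w-split {i} {p} i≤p (≤′-step {t} p<t) = begin
    w i (suc t)
      ≡⟨ w-∷ʳ (ℕP.≤-trans i≤p (ℕP.<⇒≤ (ℕP.≤′⇒≤ p<t))) ⟩
    w i t ++ syllable (suc t)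
      ≡⟨ cong (_++ syllable (suc t)) (w-split i≤p p<t) ⟩
    (w i p ++ (edg (y (suc p)) , false) ∷ w (suc p) t) ++ syllable (suc t)
      ≡⟨ ListP.++-assoc (w i p) _ _ ⟩
    w i p ++ (edg (y (suc p)) , false) ∷ (w (suc p) t ++ syllable (suc t))
      ≡⟨ cong (λ v → w i p ++ (edg (y (suc p)) , false) ∷ v) (w-∷ʳ (ℕP.≤′⇒≤ p<t)) ⟨
    w i p ++ (edg (y (suc p)) , false) ∷ w (suc p) (suc t)                   ∎
    where open ≡-Reasoning

  origin : Point
  origin = ⟨ Vec.replicate nE (+ 0) , 0ℚ , 1ℚ ⟩

  pointBefore pointAfter : ℕ → Point
  pointBefore zero    = origin
  pointBefore (suc t) = traverse (y (suc t)) (pointAfter t)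
  pointAfter t = translate (k t) (pointBefore t)

  -- the symbol pushed by the letter y_p of w (positions p ≥ 1)
  symbolAt : ℕ → Symbol
  symbolAt p = symbol (y p) (pointAfter (p ∸ 1))

  act-w : ∀ {i j} → i ≤′ j → ∀ u → act (w i j) (u , pointBefore i) ≡ (pushAll u (map symbolAt (range (suc i) j)) , pointAfter j)
  act-w {i} ≤′-refl u = begin
    act (w i i) (u , pointBefore i)                    ≡⟨ cong (λ v → act v (u , pointBefore i)) (w-refl i) ⟩
    act (pow (vtx (a i)) (k i)) (u , pointBefore i)    ≡⟨ act-pow (a i) (k i) u (pointBefore i) ⟩
    (u , pointAfter i)                                 ≡⟨ cong (λ l → pushAll u (map symbolAt l) , pointAfter i) (range-empty (suc i) i ℕP.≤-refl) ⟨
    (pushAll u (map symbolAt (range (suc i) i)) , pointAfter i) ∎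
    where open ≡-Reasoning
  act-w {i} (≤′-step {t} i≤t) u = begin
    act (w i (suc t)) (u , pointBefore i)
      ≡⟨ cong (λ v → act v (u , pointBefore i)) (w-∷ʳ (ℕP.≤′⇒≤ i≤t)) ⟩
    act (w i t ++ syllable (suc t)) (u , pointBefore i)
      ≡⟨ act-++ (w i t) (syllable (suc t)) (u , pointBefore i) ⟩
    act (syllable (suc t)) (act (w i t) (u , pointBefore i))
      ≡⟨ cong (act (syllable (suc t))) (act-w i≤t u) ⟩
    act (syllable (suc t)) (pushAll u S , pointAfter t)
      ≡⟨ act-pow (a (suc t)) (k (suc t)) _ _ ⟩
    (push (symbolAt (suc t)) (pushAll u S) , pointAfter (suc t)) ≡⟨ cong (_, pointAfter (suc t)) (pushAllBy-∷ʳ id u S (symbolAt (suc t))) ⟨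
    (pushAll u (S ++ [ symbolAt (suc t) ]) , pointAfter (suc t))
      ≡⟨ cong (λ l → pushAll u l , pointAfter (suc t)) (ListP.map-++ symbolAt (range (suc i) t) [ suc t ]) ⟨
    (pushAll u (map symbolAt (range (suc i) t ++ [ suc t ])) , pointAfter (suc t))
      ≡⟨ cong (λ l → pushAll u (map symbolAt l) , pointAfter (suc t)) (range-∷ʳ (suc i) t (s≤s (ℕP.≤′⇒≤ i≤t))) ⟨
    (pushAll u (map symbolAt (range (suc i) (suc t))) , pointAfter (suc t)) ∎
    where
    open ≡-Reasoning
    S = map symbolAt (range (suc i) t)

  Π : ℕ → ℕ → ℚ
  Π p t = prodℚ (map (r ∘ y) (range (suc p) t))

  ρw-∷ʳ : ∀ {p t} → p ≤ t → ∀ d → ρw 𝒢 D f p (suc t) d ≡ ρw 𝒢 D f p t d ℤ.+ ρE 𝒢 D f (y (suc t)) d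
  ρw-∷ʳ {p} {t} p≤t d = foldr-map-range-∷ʳ ℤP.+-0-monoid (λ μ → ρE 𝒢 D f (y μ) d) (suc p) t (s≤s p≤t)

  Π-∷ʳ : ∀ {p t} → p ≤ t → Π p (suc t) ≡ Π p t * r (y (suc t))
  Π-∷ʳ {p} {t} p≤t = foldr-map-range-∷ʳ ℚP.*-1-monoid (r ∘ y) (suc p) t (s≤s p≤t)

  kk-∷ʳ : ∀ {p t} → p ≤ suc t → kk 𝒢 D f p (suc t) ≡ kk 𝒢 D f p t + fromℤ (k (suc t)) * Π p (suc t)
  kk-∷ʳ {p} {t} = foldr-map-range-∷ʳ ℚP.+-0-monoid (λ ν → fromℤ (k ν) * Π p ν) p t

  ρw-refl : ∀ p d → ρw 𝒢 D f p p d ≡ + 0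
  ρw-refl p d = cong (λ l → sumℤ (map (λ μ → ρE 𝒢 D f (y μ) d) l)) (range-empty (suc p) p ℕP.≤-refl)

  Π-refl : ∀ p → Π p p ≡ 1ℚ
  Π-refl p = cong (λ l → prodℚ (map (r ∘ y) l)) (range-empty (suc p) p ℕP.≤-refl)

  kk-refl : ∀ p → kk 𝒢 D f p p ≡ fromℤ (k p)
  kk-refl p = begin
    kk 𝒢 D f p p                  ≡⟨ cong (λ l → sumℚ (map (λ ν → fromℤ (k ν) * Π p ν) l)) (range-single p) ⟩
    fromℤ (k p) * Π p p + 0ℚ      ≡⟨ ℚP.+-identityʳ _ ⟩
    fromℤ (k p) * Π p p           ≡⟨ cong (fromℤ (k p) *_) (Π-refl p) ⟩
    fromℤ (k p) * 1ℚ              ≡⟨ ℚP.*-identityʳ _ ⟩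
    fromℤ (k p)                   ∎
    where open ≡-Reasoning

  level-pointAfter : ∀ {p q} → p ≤′ q → ∀ d → lookup (level (pointAfter q)) d ≡ lookup (level (pointBefore p)) d ℤ.+ ρw 𝒢 D f p q d
  level-pointAfter {p} ≤′-refl d = sym (trans (cong (λ x → lookup (level (pointBefore p)) d ℤ.+ x) (ρw-refl p d)) (ℤP.+-identityʳ _))
  level-pointAfter {p} (≤′-step {t} p≤t) d = begin
    lookup (level (pointAfter t) ⊕ ρ (y (suc t))) d
      ≡⟨ lookup-⊕ρ (level (pointAfter t)) (y (suc t)) d ⟩
    lookup (level (pointAfter t)) d ℤ.+ ρE 𝒢 D f (y (suc t)) d
      ≡⟨ cong (ℤ._+ ρE 𝒢 D f (y (suc t)) d) (level-pointAfter p≤t d) ⟩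
    lookup l d ℤ.+ ρw 𝒢 D f p t d ℤ.+ ρE 𝒢 D f (y (suc t)) d
      ≡⟨ ℤP.+-assoc (lookup l d) _ _ ⟩
    lookup l d ℤ.+ (ρw 𝒢 D f p t d ℤ.+ ρE 𝒢 D f (y (suc t)) d)
      ≡⟨ cong (λ x → lookup l d ℤ.+ x) (ρw-∷ʳ (ℕP.≤′⇒≤ p≤t) d) ⟨
    lookup l d ℤ.+ ρw 𝒢 D f p (suc t) d                                    ∎
    where
    open ≡-Reasoning
    l = level (pointBefore p)

  scale-pointAfter : ∀ {p q} → p ≤′ q → scale (pointAfter q) ≡ scale (pointBefore p) * Π p q
  scale-pointAfter {p} ≤′-refl = sym (trans (cong (scale (pointBefore p) *_) (Π-refl p)) (ℚP.*-identityʳ _))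
  scale-pointAfter {p} (≤′-step {t} p≤t) = begin
    scale (pointAfter t) * r (y (suc t))                 ≡⟨ cong (_* r (y (suc t))) (scale-pointAfter p≤t) ⟩
    scale (pointBefore p) * Π p t * r (y (suc t))        ≡⟨ ℚP.*-assoc (scale (pointBefore p)) _ _ ⟩
    scale (pointBefore p) * (Π p t * r (y (suc t)))      ≡⟨ cong (scale (pointBefore p) *_) (Π-∷ʳ (ℕP.≤′⇒≤ p≤t)) ⟨
    scale (pointBefore p) * Π p (suc t)                  ∎
    where open ≡-Reasoning

  position-pointAfter : ∀ {p q} → p ≤′ q → position (pointAfter q) ≡ position (pointBefore p) + scale (pointBefore p) * kk 𝒢 D f p q
  position-pointAfter {p} ≤′-refl =
    cong (λ x → position (pointBefore p) + x) (trans (ℚP.*-comm (fromℤ (k p)) _) (cong (scale (pointBefore p) *_) (sym (kk-refl p))))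
  position-pointAfter {p} (≤′-step {t} p≤t) = begin
    position (pointAfter t) + fromℤ (k (suc t)) * (scale (pointAfter t) * r (y (suc t)))
      ≡⟨ cong₂ (λ x z → x + fromℤ (k (suc t)) * (z * r (y (suc t)))) (position-pointAfter p≤t) (scale-pointAfter p≤t) ⟩
    T + s * kk 𝒢 D f p t + fromℤ (k (suc t)) * (s * Π p t * r (y (suc t)))
      ≡⟨ solve 6 (λ T s K k P r → T :+ s :* K :+ k :* (s :* P :* r) := T :+ s :* (K :+ k :* (P :* r))) refl
               T s (kk 𝒢 D f p t) (fromℤ (k (suc t))) (Π p t) (r (y (suc t))) ⟩
    T + s * (kk 𝒢 D f p t + fromℤ (k (suc t)) * (Π p t * r (y (suc t))))
      ≡⟨ cong (λ P → T + s * (kk 𝒢 D f p t + fromℤ (k (suc t)) * P)) (Π-∷ʳ (ℕP.≤′⇒≤ p≤t)) ⟨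
    T + s * (kk 𝒢 D f p t + fromℤ (k (suc t)) * Π p (suc t))
      ≡⟨ cong (λ K → T + s * K) (kk-∷ʳ (ℕP.m≤n⇒m≤1+n (ℕP.≤′⇒≤ p≤t))) ⟨
    T + s * kk 𝒢 D f p (suc t) ∎
    where
    open ≡-Reasoning
    T = position (pointBefore p)
    s = scale (pointBefore p)

  scale≡σ-level : ∀ t → scale (pointBefore t) ≡ σ (level (pointBefore t))
  scale≡σ-level zero    = sym σ-0
  scale≡σ-level (suc t) = trans (cong (_* r (y (suc t))) (scale≡σ-level t)) (sym (σ-⊕ρ (level (pointBefore t)) (y (suc t))))

  scale≢0 : ∀ t → scale (pointBefore t) ≢ 0ℚ
  scale≢0 zero    = λ ()
  scale≢0 (suc t) = *-≢0 (scale≢0 t) (r≢0 (y (suc t)))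

  ρw-off-D : ∀ p t d → inD d ≡ false → ρw 𝒢 D f p t d ≡ + 0
  ρw-off-D p t d d∉D rewrite d∉D = sum-zeros (range (suc p) t)
    where
    sum-zeros : ∀ xs → sumℤ (map (λ _ → + 0) xs) ≡ + 0
    sum-zeros []       = refl
    sum-zeros (_ ∷ xs) = trans (ℤP.+-identityˡ _) (sum-zeros xs)

  level-pointAfter≡⇔ρ-zero : ∀ {p q} → p ≤′ q → (level (pointAfter q) ≡ level (pointBefore p)) ⇔ ρ-zero 𝒢 D f p q
  level-pointAfter≡⇔ρ-zero {p} {q} p≤q = mk⇔ to from
    where
    l = level (pointBefore p)
    to : level (pointAfter q) ≡ l → ρ-zero 𝒢 D f p q
    to eq d _ = ℤ+-cancelˡ (lookup l d) _ _
      (trans (sym (level-pointAfter p≤q d)) (trans (cong (λ v → lookup v d) eq) (sym (ℤP.+-identityʳ (lookup l d)))))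
    from : ρ-zero 𝒢 D f p q → level (pointAfter q) ≡ l
    from ρw≡0 = level-ext λ d → trans (level-pointAfter p≤q d) (trans (cong (λ x → lookup l d ℤ.+ x) (ρw-d≡0 d)) (ℤP.+-identityʳ (lookup l d)))
      where
      ρw-d≡0 : ∀ d → ρw 𝒢 D f p q d ≡ + 0
      ρw-d≡0 d = by-membership (inD d) refl
        where
        by-membership : ∀ b → inD d ≡ b → ρw 𝒢 D f p q d ≡ + 0
        by-membership true  d∈D = ρw≡0 d d∈D
        by-membership false d∉D = ρw-off-D p q d d∉D

  module _ {p t : ℕ} (1+p≤t : suc p ≤′ t) where
    private
      e = y (suc p)
      P = pointBefore (suc p)
      T = position P
      S = scale P
      K = kk 𝒢 D f (suc p) t

    inverse-symbolAt : inverse (symbolAt (suc p)) ≡ (bar e , level P , T mod (fromℤ (β e) * S))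
    inverse-symbolAt = cong (λ M → bar e , level P , T mod M) (sym (β*[s*r] e (scale (pointAfter p))))

    symbolAt-balanced : y (suc t) ≡ bar e → level (pointAfter t) ≡ level P →
                        symbolAt (suc t) ≡ (bar e , level P , (T + S * K) mod (fromℤ (β e) * S))
    symbolAt-balanced y≡ē same-level = begin
      y (suc t) , level (pointAfter t) , position (pointAfter t) mod (fromℤ (α (y (suc t))) * scale (pointAfter t))
        ≡⟨ cong (λ e' → e' , level (pointAfter t) , position (pointAfter t) mod (fromℤ (α e') * scale (pointAfter t))) y≡ē ⟩
      bar e , level (pointAfter t) , position (pointAfter t) mod (fromℤ (α (bar e)) * scale (pointAfter t))
        ≡⟨ cong₂ (λ l M → bar e , l , position (pointAfter t) mod M) same-level (cong₂ (λ b s → fromℤ b * s) (α-bar e) same-scale) ⟩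
      bar e , level P , position (pointAfter t) mod (fromℤ (β e) * S)
        ≡⟨ cong (λ T' → bar e , level P , T' mod (fromℤ (β e) * S)) (position-pointAfter 1+p≤t) ⟩
      bar e , level P , (T + S * K) mod (fromℤ (β e) * S) ∎
      where
      open ≡-Reasoning
      same-scale : scale (pointAfter t) ≡ S
      same-scale = trans (scale≡σ-level t) (trans (cong σ same-level) (sym (scale≡σ-level (suc p))))

    inverse-symbolAt⇔ : (symbolAt (suc t) ≡ inverse (symbolAt (suc p))) ⇔
                        (e ≡ bar (y (suc t)) × ρ-zero 𝒢 D f (suc p) t × _∈βℤ_ 𝒢 D f K (β e))
    inverse-symbolAt⇔ = mk⇔ to from
      where
      residue⇔ = +-*-mod-≡⇔ (β e) T K (scale≢0 (suc p)) (β-nz e)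
      level⇔ = level-pointAfter≡⇔ρ-zero 1+p≤t
      flip-bar : ∀ {e₁ e₂} → e₁ ≡ bar e₂ → e₂ ≡ bar e₁
      flip-bar {e₁} {e₂} eq = trans (sym (bar-invol e₂)) (cong bar (sym eq))
      to : symbolAt (suc t) ≡ inverse (symbolAt (suc p)) → _
      to E = flip-bar y≡ē , Equivalence.to level⇔ same-level , Equivalence.to residue⇔ (cong (proj₂ ∘ proj₂)
               (trans (sym (symbolAt-balanced y≡ē same-level)) (trans E inverse-symbolAt)))
        where
        y≡ē = cong proj₁ E
        same-level = cong (proj₁ ∘ proj₂) E
      from : _ → symbolAt (suc t) ≡ inverse (symbolAt (suc p))
      from (e≡ȳ , ρw≡0 , K∈βℤ) = trans (symbolAt-balanced (flip-bar e≡ȳ) (Equivalence.from level⇔ ρw≡0))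
        (trans (cong (λ R → bar e , level P , R) (Equivalence.from residue⇔ K∈βℤ)) (sym inverse-symbolAt))

  _∼_ : ℕ → ℕ → Set
  _∼_ = _∼C_ 𝒢 D f

  ∼-sym : ∀ {p q} → p ∼ q → q ∼ p
  ∼-sym {p} {q} (yp≡ȳq , p<q⇒ , q<p⇒) = trans (sym (bar-invol (y q))) (cong bar (sym yp≡ȳq)) , q<p⇒ , p<q⇒

  inverse-sym : ∀ {x x'} → x ≡ inverse x' → x' ≡ inverse x
  inverse-sym {x} {x'} eq = trans (sym (inverse-involutive x')) (cong inverse (sym eq))

  ∼⇔inverse-< : ∀ {p t} → suc p ≤ t → (suc p ∼ suc t) ⇔ (symbolAt (suc t) ≡ inverse (symbolAt (suc p)))
  ∼⇔inverse-< {p} {t} 1+p≤t = ⇔-sym (inverse-symbolAt⇔ (ℕP.≤⇒≤′ 1+p≤t)) ⇔-∘ mk⇔ to from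
    where
    to : suc p ∼ suc t → _
    to (e≡ȳ , if-< , _) = e≡ȳ , if-< (s≤s 1+p≤t)
    from : _ → suc p ∼ suc t
    from (e≡ȳ , conditions) = e≡ȳ , (λ _ → conditions) , (λ t<p → contradiction t<p (ℕP.<-asym (s≤s 1+p≤t)))

  ∼⇔inverse : ∀ {p q} → 1 ≤ p → 1 ≤ q → (p ∼ q) ⇔ (symbolAt q ≡ inverse (symbolAt p))
  ∼⇔inverse {suc p} {suc t} _ _ with ℕP.<-cmp p t
  ... | tri< p<t _ _ = ∼⇔inverse-< p<t
  ... | tri≈ _ refl _ = mk⇔ (λ p∼p → contradiction (sym (proj₁ p∼p)) (bar-fpf (y (suc p))))
                            (λ eq → contradiction (sym (cong proj₁ eq)) (bar-fpf (y (suc p))))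
  ... | tri> _ _ t<p = mk⇔ (inverse-sym ∘ Equivalence.to (∼⇔inverse-< t<p) ∘ ∼-sym)
                           (∼-sym ∘ Equivalence.from (∼⇔inverse-< t<p) ∘ inverse-sym)

module Segments (𝒢 : GBSGraph) (D : GBSGraph.Orientation 𝒢) (f : Factorization 𝒢) where
  open GBSGraph 𝒢
  open Factorization f
  open Action 𝒢 D f
  open Walk 𝒢 D f
  open Presentation Relator
  open Conjugation 𝒢 using (merge-word)

  act-w-cyclic : ∀ {i j m} → i ≤′ j → w i j ≈F pow (vtx (a i)) m →
                 (pushAll [] (map symbolAt (range (suc i) j)) , pointAfter j) ≡ ([] , translate m (pointBefore i))
  act-w-cyclic {i} {j} {m} i≤j w≈a^m = begin
    (pushAll [] (map symbolAt (range (suc i) j)) , pointAfter j)  ≡⟨ act-w i≤j [] ⟨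
    act (w i j) ([] , pointBefore i)                              ≡⟨ act-≈F w≈a^m (pointBefore i) [] ⟩
    act (pow (vtx (a i)) m) ([] , pointBefore i)                  ≡⟨ act-pow (a i) m [] (pointBefore i) ⟩
    ([] , translate m (pointBefore i))                            ∎
    where open ≡-Reasoning

  kk≡exponent : ∀ {i j m} → i ≤′ j → w i j ≈F pow (vtx (a i)) m → kk 𝒢 D f i j ≡ fromℤ m
  kk≡exponent {i} {j} {m} i≤j w≈a^m = *-cancelˡ-≢0 S (scale≢0 i) (ℚ+-cancelˡ T _ _ (begin
    T + S * kk 𝒢 D f i j          ≡⟨ position-pointAfter i≤j ⟨
    position (pointAfter j)       ≡⟨ cong (position ∘ proj₂) (act-w-cyclic {m = m} i≤j w≈a^m) ⟩
    T + fromℤ m * S               ≡⟨ cong (λ x → T + x) (ℚP.*-comm (fromℤ m) S) ⟩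
    T + S * fromℤ m               ∎))
    where
    open ≡-Reasoning
    T = position (pointBefore i)
    S = scale (pointBefore i)

  CyclicSegment : ℕ → ℕ → Set
  CyclicSegment x c = x ≤ c × a c ≡ a x × InCyclic 𝒢 D f x c

  cyclicSegment-refl : ∀ t → CyclicSegment t t
  cyclicSegment-refl t = ℕP.≤-refl , refl , k t , ≈-reflexive (w-refl t)

  merge : ∀ {x p t} → CyclicSegment x p → CyclicSegment (suc p) t → t < n →
          symbolAt (suc t) ≡ inverse (symbolAt (suc p)) → CyclicSegment x (suc t)
  merge {x} {p} {t} (x≤p , ap≡ax , m₁ , w₁) (1+p≤t , _ , m₂ , w₂) t<n E =
    ℕP.≤-trans x≤p (ℕP.≤-trans (ℕP.n≤1+n p) (ℕP.m≤n⇒m≤1+n 1+p≤t)) ,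
    trans a[1+t]≡ιe (sym ax≡ιe) ,
    m₁ ℤ.+ (α e ℤ.* z ℤ.+ k (suc t)) , (begin
      w x (suc t)                                                ≡⟨ w-split x≤p (ℕP.≤⇒≤′ (ℕP.m≤n⇒m≤1+n 1+p≤t)) ⟩
      w x p ++ (edg e , false) ∷ w (suc p) (suc t)               ≡⟨ cong (λ v → w x p ++ (edg e , false) ∷ v) (w-∷ʳ 1+p≤t) ⟩
      w x p ++ (edg e , false) ∷ (w (suc p) t ++ syllable (suc t)) ≈⟨ ++-cong w₁ (∷-cong (edg e , false) (++-congʳ (syllable (suc t)) w₂')) ⟩
      pow (vtx (a x)) m₁ ++ (edg e , false) ∷ (pow (vtx (a (suc p))) (β e ℤ.* z) ++ syllable (suc t))
                                                                  ≈⟨ merge-word e m₁ z (k (suc t)) ax≡ιe a[1+p]≡τe y[1+t]≡ē a[1+t]≡ιe ⟩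
      pow (vtx (a x)) (m₁ ℤ.+ (α e ℤ.* z ℤ.+ k (suc t)))         ∎)
    where
    open ≈-Reasoning
    e = y (suc p)
    1+p≤n = ℕP.≤-trans 1+p≤t (ℕP.<⇒≤ t<n)
    conditions = Equivalence.to (inverse-symbolAt⇔ (ℕP.≤⇒≤′ 1+p≤t)) E
    z = proj₁ (proj₂ (proj₂ conditions))
    m₂≡β*z : m₂ ≡ β e ℤ.* z
    m₂≡β*z = fromℤ-injective (trans (sym (kk≡exponent {m = m₂} (ℕP.≤⇒≤′ 1+p≤t) w₂)) (proj₂ (proj₂ (proj₂ conditions))))
    w₂' : w (suc p) t ≈ pow (vtx (a (suc p))) (β e ℤ.* z)
    w₂' = subst (λ m → w (suc p) t ≈ pow (vtx (a (suc p))) m) m₂≡β*z w₂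
    y[1+t]≡ē : y (suc t) ≡ bar e
    y[1+t]≡ē = cong proj₁ E
    ax≡ιe : a x ≡ ι e
    ax≡ιe = trans (sym ap≡ax) (sym (ι-y (suc p) (s≤s z≤n) 1+p≤n))
    a[1+p]≡τe : a (suc p) ≡ τ e
    a[1+p]≡τe = sym (τ-y (suc p) (s≤s z≤n) 1+p≤n)
    a[1+t]≡ιe : a (suc t) ≡ ι e
    a[1+t]≡ιe = trans (sym (τ-y (suc t) (s≤s z≤n) t<n)) (trans (cong τ y[1+t]≡ē) (sym (ι-bar e)))

  -- A stack p₁ ∷ … ∷ pₖ (top first) with b < pₖ < … < p₁ ≤ t cuts w_{b,t} into
  -- w_{b,pₖ-1} y_{pₖ} ⋯ w_{p₂,p₁-1} y_{p₁} w_{p₁,t}, each w-piece lying in its cyclic subgroup.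
  Stacked : ℕ → List ℕ → ℕ → Set
  Stacked b []       t = CyclicSegment b t
  Stacked b (p ∷ ps) t = CyclicSegment p t × Stacked b ps (p ∸ 1) × b < p

  Stacked⇒≤ : ∀ {b} S {t} → Stacked b S t → b ≤ t
  Stacked⇒≤ []       (b≤t , _)              = b≤t
  Stacked⇒≤ (p ∷ ps) ((p≤t , _) , _ , b<p)  = ℕP.≤-trans (ℕP.<⇒≤ b<p) p≤t

  Stacked-push : ∀ {b} S {t} → Stacked b S t → t < n → Stacked b (pushBy symbolAt (suc t) S) (suc t)
  Stacked-push []           stacked t<n = cyclicSegment-refl _ , stacked , s≤s (Stacked⇒≤ [] stacked)
  Stacked-push (zero ∷ ps)  (_ , _ , ()) t<n
  Stacked-push (suc p ∷ ps) {t} stacked t<n with symbolAt (suc t) ≟ˢ inverse (symbolAt (suc p))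
  Stacked-push (suc p ∷ [])      (seg , seg-b , _) t<n | yes E = merge seg-b seg t<n E
  Stacked-push (suc p ∷ p' ∷ ps) (seg , (seg' , rest , b<p') , _) t<n | yes E = merge seg' seg t<n E , rest , b<p'
  ... | no _ = cyclicSegment-refl _ , stacked , s≤s (Stacked⇒≤ (suc p ∷ ps) stacked)

  Stacked-range : ∀ {i j} → i ≤′ j → j ≤ n → Stacked i (pushAllBy symbolAt [] (range (suc i) j)) j
  Stacked-range {i} ≤′-refl _ = subst (λ l → Stacked i (pushAllBy symbolAt [] l) i) (sym (range-empty (suc i) i ℕP.≤-refl)) (cyclicSegment-refl i)
  Stacked-range {i} (≤′-step {t} i≤t) 1+t≤n = subst (λ S → Stacked i S (suc t)) (sym pushed)
    (Stacked-push _ (Stacked-range i≤t (ℕP.<⇒≤ 1+t≤n)) 1+t≤n)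
    where
    pushed : pushAllBy symbolAt [] (range (suc i) (suc t)) ≡ pushBy symbolAt (suc t) (pushAllBy symbolAt [] (range (suc i) t))
    pushed = trans (cong (pushAllBy symbolAt []) (range-∷ʳ (suc i) t (s≤s (ℕP.≤′⇒≤ i≤t)))) (pushAllBy-∷ʳ symbolAt [] (range (suc i) t) (suc t))

module FreeGroupΛ (𝒢 : GBSGraph) (D : GBSGraph.Orientation 𝒢) (f : Factorization 𝒢) where
  open Factorization f using (n)
  open Action 𝒢 D f
  open Walk 𝒢 D f
  open Segments 𝒢 D f using (act-w-cyclic; Stacked; Stacked-range)
  open Presentation (ΛRelator 𝒢 D f) using (≈-refl; ≈-trans; ≈-reflexive; ++-congʳ; step) renaming (_≈_ to _≈Λ_)

  index : Fin n → ℕ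
  index = idx 𝒢 D f

  1≤index : ∀ m → 1 ≤ index m
  1≤index m = s≤s z≤n

  symbolOf : Fin n → Symbol
  symbolOf = symbolAt ∘ index

  actΛL : Letter (Fin n) → List Symbol → List Symbol
  actΛL (m , false) = push (symbolOf m)
  actΛL (m , true)  = push (inverse (symbolOf m))

  open LetterAction actΛL using () renaming (act to actΛ)

  push-cancels : ∀ {x x'} → x' ≡ inverse x → ∀ {u} → Reduced u → push x' (push x u) ≡ u
  push-cancels {x} refl red = push-inv-push x red

  actΛ-respects-≈ : ∀ {v v'} → v ≈Λ v' → actΛ v [] ≡ actΛ v' []
  actΛ-respects-≈ v≈v' = LetterAction.act-respects-≈ actΛL Reduced actΛL-reduced cancel-trivial relator-trivial v≈v' []
    where
    actΛL-reduced : ∀ x {u} → Reduced u → Reduced (actΛL x u)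
    actΛL-reduced (m , false) = push-reduced _
    actΛL-reduced (m , true)  = push-reduced _
    cancel-trivial : ∀ x {u} → Reduced u → actΛ (x ∷ invL x ∷ []) u ≡ u
    cancel-trivial (m , false) = push-inv-push (symbolOf m)
    cancel-trivial (m , true)  = push-push-inv (symbolOf m)
    relator-trivial : ∀ {r} → ΛRelator 𝒢 D f r → ∀ {u} → Reduced u → actΛ r u ≡ u
    relator-trivial (r-class p q (inj₁ same)) = push-cancels (cong (inverse ∘ symbolAt) (sym same))
    relator-trivial (r-class p q (inj₂ (ℓ , 1≤ℓ , _ , p∼ℓ , ℓ∼q))) = push-cancels (cong inverse (trans
      (Equivalence.to (∼⇔inverse 1≤ℓ (1≤index q)) ℓ∼q)
      (trans (cong inverse (Equivalence.to (∼⇔inverse (1≤index p) 1≤ℓ) p∼ℓ)) (inverse-involutive (symbolOf p)))))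
    relator-trivial (r-inv p q p∼q) = push-cancels (Equivalence.to (∼⇔inverse (1≤index p) (1≤index q)) p∼q)

  Λword : List (Fin n) → Word (Fin n)
  Λword = map (_, false)

  actΛ-Λword : ∀ L u → actΛ (Λword L) u ≡ pushAll u (map symbolOf L)
  actΛ-Λword []      u = refl
  actΛ-Λword (m ∷ L) u = actΛ-Λword L (push (symbolOf m) u)

  Λword-reverse-∷ : ∀ q ps → Λword (reverse (q ∷ ps)) ≡ Λword (reverse ps) ++ [ (q , false) ]
  Λword-reverse-∷ q ps = trans (cong Λword (ListP.unfold-reverse q ps)) (ListP.map-++ (_, false) (reverse ps) [ q ])

  Λword-pushBy : ∀ q ps → Λword (reverse ps) ++ [ (q , false) ] ≈Λ Λword (reverse (pushBy symbolOf q ps))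
  Λword-pushBy q [] = ≈-refl
  Λword-pushBy q (p ∷ ps) with symbolOf q ≟ˢ inverse (symbolOf p)
  ... | yes q-cancels-p = ≈-trans (≈-reflexive shape) (≈-trans (step (delrel (Λword (reverse ps)) [] _ (r-inv p q p∼q)))
                                                             (≈-reflexive (ListP.++-identityʳ _)))
    where
    p∼q = Equivalence.from (∼⇔inverse (1≤index p) (1≤index q)) q-cancels-p
    shape : Λword (reverse (p ∷ ps)) ++ [ (q , false) ] ≡ Λword (reverse ps) ++ ((p , false) ∷ (q , false) ∷ []) ++ []
    shape = trans (cong (_++ [ (q , false) ]) (Λword-reverse-∷ p ps)) (ListP.++-assoc (Λword (reverse ps)) [ (p , false) ] [ (q , false) ])
  ... | no _ = ≈-reflexive (sym (Λword-reverse-∷ q (p ∷ ps)))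

  Λword≈reduced : ∀ acc L → Λword (reverse acc) ++ Λword L ≈Λ Λword (reverse (pushAllBy symbolOf acc L))
  Λword≈reduced acc []      = ≈-reflexive (ListP.++-identityʳ _)
  Λword≈reduced acc (q ∷ L) = ≈-trans (≈-reflexive (sym (ListP.++-assoc (Λword (reverse acc)) [ (q , false) ] (Λword L))))
                                      (≈-trans (++-congʳ (Λword L) (Λword-pushBy q acc)) (Λword≈reduced (pushBy symbolOf q acc) L))

  letters : ℕ → ℕ → List (Fin n)
  letters i j = filter (λ m → (i ℕ.<? index m) ×-dec (index m ℕ.≤? j)) (allFin n)

  index-letters : ∀ i j → j ≤ n → map index (letters i j) ≡ range (suc i) j
  index-letters i j j≤n = begin
    map index (letters i j)                                           ≡⟨ map-filter index (λ x → (i ℕ.<? x) ×-dec (x ℕ.≤? j)) (allFin n) ⟩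
    filter (λ x → (i ℕ.<? x) ×-dec (x ℕ.≤? j)) (map index (allFin n)) ≡⟨ cong (filter _) (map-suc∘toℕ-allFin n) ⟩
    filter (λ x → (i ℕ.<? x) ×-dec (x ℕ.≤? j)) (range 1 n)            ≡⟨ filter-range i j n ⟩
    range (suc i) (j ℕ.⊓ n)                                           ≡⟨ cong (range (suc i)) (ℕP.m≤n⇒m⊓n≡m j≤n) ⟩
    range (suc i) j                                                   ∎
    where open ≡-Reasoning

  positions : ℕ → ℕ → List ℕ
  positions i j = pushAllBy symbolAt [] (range (suc i) j)

  positions≡[] : ∀ {i j} → pushAll [] (map symbolAt (range (suc i) j)) ≡ [] → positions i j ≡ []
  positions≡[] {i} {j} empty = map-≡[] symbolAt (trans (map-pushAllBy symbolAt id [] (range (suc i) j)) empty)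

  cyclic⇒𝒞-trivial : ∀ {i j} → i ≤′ j → j ≤ n → InCyclic 𝒢 D f i j → 𝒞Trivial 𝒢 D f i j
  cyclic⇒𝒞-trivial {i} {j} i≤j j≤n (m , w≈a^m) = ≈-trans (Λword≈reduced [] (letters i j)) (≈-reflexive (cong (Λword ∘ reverse) reduced≡[]))
    where
    reduced≡[] : pushAllBy symbolOf [] (letters i j) ≡ []
    reduced≡[] = map-≡[] index (begin
      map index (pushAllBy symbolOf [] (letters i j))         ≡⟨ map-pushAllBy index symbolAt [] (letters i j) ⟩
      pushAllBy symbolAt [] (map index (letters i j))         ≡⟨ cong (pushAllBy symbolAt []) (index-letters i j j≤n) ⟩
      positions i j                                           ≡⟨ positions≡[] {i} {j} (cong proj₁ (act-w-cyclic {m = m} i≤j w≈a^m)) ⟩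
      []                                                      ∎)
      where open ≡-Reasoning

  𝒞-trivial⇒cyclic : ∀ {i j} → i ≤′ j → j ≤ n → 𝒞Trivial 𝒢 D f i j → InCyclic 𝒢 D f i j
  𝒞-trivial⇒cyclic {i} {j} i≤j j≤n 𝒞≈[] =
    proj₂ (proj₂ (subst (λ S → Stacked i S j) (positions≡[] {i} {j} stack≡[]) (Stacked-range i≤j j≤n)))
    where
    stack≡[] : pushAll [] (map symbolAt (range (suc i) j)) ≡ []
    stack≡[] = begin
      pushAll [] (map symbolAt (range (suc i) j))             ≡⟨ cong (pushAll [] ∘ map symbolAt) (index-letters i j j≤n) ⟨
      pushAll [] (map symbolAt (map index (letters i j)))     ≡⟨ cong (pushAll []) (ListP.map-∘ (letters i j)) ⟨
      pushAll [] (map symbolOf (letters i j))                 ≡⟨ actΛ-Λword (letters i j) [] ⟨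
      actΛ (𝒞 𝒢 D f i j) []                                   ≡⟨ actΛ-respects-≈ 𝒞≈[] ⟩
      []                                                      ∎
      where open ≡-Reasoning

mainTheorem8 : (𝒢 : GBSGraph) → GBSGraph.Connected 𝒢
    → (D : GBSGraph.Orientation 𝒢) → (f : Factorization 𝒢)
    → ∀ i j → i ≤ j → j ≤ Factorization.n f
    → (InCyclic 𝒢 D f i j → 𝒞Trivial 𝒢 D f i j) × (𝒞Trivial 𝒢 D f i j → InCyclic 𝒢 D f i j)
mainTheorem8 𝒢 _ D f i j i≤j j≤n = cyclic⇒𝒞-trivial (ℕP.≤⇒≤′ i≤j) j≤n , 𝒞-trivial⇒cyclic (ℕP.≤⇒≤′ i≤j) j≤n
  where open FreeGroupΛ 𝒢 D f
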